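{- Let $(W,S)$ be a Coxeter system. Consider the random walk on $W$ started at the identity $1_W$ which, at each step, multiplies the current element on the right by an element chosen uniformly at random from $S \cup \{1_W\}$, and let $P^n(x)$ be the probability that the walk is at $x\in W$ after $n$ steps. Let $w \in W$ and $s \in S$ with $l(ws) > l(w)$. Then for every $n\ge 0$, $P^n(ws) \leq P^n(w)$.
   Context: A Coxeter system $(W,S)$ is a group $W$ with generating set $S=\{s_1,\dots,s_k\}$ and presentation $\langle s_1,\dots,s_k \mid s_i^2,\ (s_is_j)^{m_{ij}}\ (i\neq j)\rangle$, where each $m_{ij}$ ($i\ne j$) is an integer $\geq 2$ or $\infty$. For $x\in W$, $l(x)$ denotes the length of a shortest word in $S$ representing $x$. -}

module Defs where

open import Data.Nat using (ℕ; zero; suc; _≤_; _<_; _^_)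
open import Data.Nat.Properties using (m^n≢0)
open import Data.Fin using (Fin)
open import Data.Maybe using (Maybe; just; nothing)
open import Data.List using (List; []; _∷_; _++_; length; concat; replicate)
open import Data.List.Membership.Propositional using (_∈_)
open import Data.List.Relation.Unary.Unique.Propositional using (Unique)
open import Data.Vec using (Vec; toList)
open import Data.Integer using (+_)
open import Data.Rational.Unnormalised using (ℚᵘ; _/_)
open import Data.Product using (Σ; _×_; _,_)
open import Data.Sum using (_⊎_)
open import Relation.Binary.PropositionalEquality using (_≡_; _≢_)
open import Function.Bundles using (_⇔_)

-- A Coxeter matrix on k generators: m i j ∈ ℕ ∪ {∞}, with ∞ encoded as 'nothing'.
CoxMatrix : ℕ → Set
CoxMatrix k = Fin k → Fin k → Maybe ℕ

IsCoxeterMatrix : {k : ℕ} → CoxMatrix k → Set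
IsCoxeterMatrix {k} m =
  ((i j : Fin k) → m i j ≡ m j i) ×
  ((i j : Fin k) → i ≢ j → (m i j ≡ nothing) ⊎ Σ ℕ (λ n → (m i j ≡ just n) × (2 ≤ n)))

Word : ℕ → Set
Word k = List (Fin k)

alt : {k : ℕ} → Fin k → Fin k → ℕ → Word k
alt i j n = concat (replicate n (i ∷ j ∷ []))

-- The congruence on words generated by the Coxeter relators s_i² and
-- (s_i s_j)^{m_ij} (i ≠ j, m_ij finite). Words modulo this relation form W.
data _≈⟨_⟩_ {k : ℕ} : Word k → CoxMatrix k → Word k → Set where
  ≈-refl  : ∀ {m u} → u ≈⟨ m ⟩ u
  ≈-sym   : ∀ {m u v} → u ≈⟨ m ⟩ v → v ≈⟨ m ⟩ u
  ≈-trans : ∀ {m u v w} → u ≈⟨ m ⟩ v → v ≈⟨ m ⟩ w → u ≈⟨ m ⟩ w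
  ≈-sq    : ∀ {m} (u v : Word k) (i : Fin k) →
            (u ++ (i ∷ i ∷ []) ++ v) ≈⟨ m ⟩ (u ++ v)
  ≈-braid : ∀ {m} (u v : Word k) (i j : Fin k) (n : ℕ) → i ≢ j → m i j ≡ just n →
            (u ++ alt i j n ++ v) ≈⟨ m ⟩ (u ++ v)

HasLength : {k : ℕ} → CoxMatrix k → Word k → ℕ → Set
HasLength {k} m x n =
  Σ (Word k) (λ u → (u ≈⟨ m ⟩ x) × (length u ≡ n)) ×
  ((u : Word k) → u ≈⟨ m ⟩ x → n ≤ length u)

-- One step of the walk: choose from S ∪ {1_W}; 'zero' is 1_W, 'suc i' is s_i.
Step : ℕ → Set
Step k = Fin (suc k)

stepWord : {k : ℕ} → Step k → Word k
stepWord Fin.zero = []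
stepWord (Fin.suc i) = i ∷ []

walkWord : {k : ℕ} → List (Step k) → Word k
walkWord [] = []
walkWord (t ∷ ts) = stepWord t ++ walkWord ts

WalkCount : {k : ℕ} → CoxMatrix k → ℕ → Word k → ℕ → Set
WalkCount {k} m n x c =
  Σ (List (Vec (Step k) n)) (λ L →
    Unique L × (length L ≡ c) ×
    ((σ : Vec (Step k) n) → (σ ∈ L) ⇔ (walkWord (toList σ) ≈⟨ m ⟩ x)))

WalkProb : {k : ℕ} → CoxMatrix k → ℕ → Word k → ℚᵘ → Set
WalkProb {k} m n x p =
  Σ ℕ (λ c → WalkCount m n x c × (p ≡ (+ c) / (suc k ^ n)))
  where instance _ = m^n≢0 (suc k) n

-- Let t = w s w⁻¹. Since l(w) < l(ws), the wall of the reflection t separates ws from 1 and w: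
-- every gallery to ws crosses it an odd number of times (Tits' parity cocycle). Reflect a walk
-- in this wall from the first moment it touches it, by exchanging an idle step with the step
-- by the generator equal to the wall seen at that moment. This is an involution on step
-- sequences taking walks that end at ws to walks that end at t ws = w, so P^n(ws) ≤ P^n(w).
-- For it to be an involution, distinct generators must be distinct in W. Without real numbers
-- this is shown with an integer analogue of the geometric representation: 4 cos² (π / m) is
-- replaced by the operator 2 + T + T⁻¹, T a translation acting on ℤ-valued functions on a
-- lattice whose window sums of length m vanish.

module Submission where

module CoxeterWords where
  open import Defs
  open import Data.Nat as ℕ using (ℕ; zero; suc)
  open import Data.Fin using (Fin)
  open import Data.List using (List; []; _∷_; _++_; reverse)
  import Data.List.Properties as ListP
  open import Relation.Binary.PropositionalEquality

  ++-reassoc : ∀ {A : Set} (x u r v y : List A) → x ++ (u ++ r ++ v) ++ y ≡ (x ++ u) ++ r ++ (v ++ y)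
  ++-reassoc x u r v y =
    trans (cong (x ++_) (trans (ListP.++-assoc u (r ++ v) y) (cong (u ++_) (ListP.++-assoc r v y)))) (sym (ListP.++-assoc x u (r ++ (v ++ y))))

  module _ {k : ℕ} (i j : Fin k) where

    alt-+ : ∀ p q → alt i j (p ℕ.+ q) ≡ alt i j p ++ alt i j q
    alt-+ zero q = refl
    alt-+ (suc p) q = cong (λ u → i ∷ j ∷ u) (alt-+ p q)

    alt-suc-snoc : ∀ n → alt i j (suc n) ≡ alt i j n ++ (i ∷ j ∷ [])
    alt-suc-snoc zero = refl
    alt-suc-snoc (suc n) = cong (λ u → i ∷ j ∷ u) (alt-suc-snoc n)

  alt-suc-cons : ∀ {k} (i j : Fin k) n → alt i j (suc n) ≡ i ∷ (alt j i n ++ j ∷ [])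
  alt-suc-cons i j zero = refl
  alt-suc-cons i j (suc n) = cong (λ u → i ∷ j ∷ u) (alt-suc-cons i j n)

  module Words {k : ℕ} (m : CoxMatrix k) where
    infix 4 _≈_
    _≈_ : Word k → Word k → Set
    u ≈ v = u ≈⟨ m ⟩ v

    ≡⇒≈ : ∀ {u v} → u ≡ v → u ≈ v
    ≡⇒≈ refl = ≈-refl

    ≈-cong : ∀ x y {u v} → u ≈ v → (x ++ u ++ y) ≈ (x ++ v ++ y)
    ≈-cong x y ≈-refl = ≈-refl
    ≈-cong x y (≈-sym u≈v) = ≈-sym (≈-cong x y u≈v)
    ≈-cong x y (≈-trans u≈v v≈w) = ≈-trans (≈-cong x y u≈v) (≈-cong x y v≈w)
    ≈-cong x y (≈-sq u v i) =
      ≈-trans (≡⇒≈ (++-reassoc x u (i ∷ i ∷ []) v y)) (≈-trans (≈-sq (x ++ u) (v ++ y) i) (≡⇒≈ (sym (++-reassoc x u [] v y))))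
    ≈-cong x y (≈-braid u v i j n i≢j mᵢⱼ) =
      ≈-trans (≡⇒≈ (++-reassoc x u (alt i j n) v y)) (≈-trans (≈-braid (x ++ u) (v ++ y) i j n i≢j mᵢⱼ) (≡⇒≈ (sym (++-reassoc x u [] v y))))

    ≈-congˡ : ∀ x {u v} → u ≈ v → (x ++ u) ≈ (x ++ v)
    ≈-congˡ x {u} {v} u≈v = ≈-trans (≡⇒≈ (cong (x ++_) (sym (ListP.++-identityʳ u)))) (≈-trans (≈-cong x [] u≈v) (≡⇒≈ (cong (x ++_) (ListP.++-identityʳ v))))

    ≈-congʳ : ∀ y {u v} → u ≈ v → (u ++ y) ≈ (v ++ y)
    ≈-congʳ y = ≈-cong [] y

    ++-reverse : ∀ x → (x ++ reverse x) ≈ []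
    ++-reverse [] = ≈-refl
    ++-reverse (a ∷ x) = ≈-trans (≡⇒≈ (cong (a ∷_) (trans (cong (x ++_) (ListP.unfold-reverse a x)) (sym (ListP.++-assoc x (reverse x) (a ∷ []))))))
                                  (≈-trans (≈-congˡ (a ∷ []) (≈-congʳ (a ∷ []) (++-reverse x))) (≈-sq [] [] a))

    reverse-++ : ∀ x → (reverse x ++ x) ≈ []
    reverse-++ x = ≈-trans (≡⇒≈ (cong (reverse x ++_) (sym (ListP.reverse-involutive x)))) (++-reverse (reverse x))

    reverse-identity : ∀ x → x ≈ [] → reverse x ≈ []
    reverse-identity x x≈[] = ≈-trans (≡⇒≈ (sym (ListP.++-identityʳ (reverse x)))) (≈-trans (≈-congˡ (reverse x) (≈-sym x≈[])) (reverse-++ x))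

    conj : Fin k → Word k → Word k
    conj a t = a ∷ (t ++ a ∷ [])

    conj-cong : ∀ a {t t′} → t ≈ t′ → conj a t ≈ conj a t′
    conj-cong a = ≈-cong (a ∷ []) (a ∷ [])

    conj-involutive : ∀ a t → conj a (conj a t) ≈ t
    conj-involutive a t = ≈-trans (≡⇒≈ (cong (λ u → a ∷ a ∷ u) (ListP.++-assoc t (a ∷ []) (a ∷ []))))
                          (≈-trans (≈-sq [] (t ++ a ∷ a ∷ []) a) (≈-trans (≈-sq t [] a) (≡⇒≈ (ListP.++-identityʳ t))))

    conj-swapˡ : ∀ a {r t} → r ≈ conj a t → conj a r ≈ t
    conj-swapˡ a {r} {t} r≈at = ≈-trans (conj-cong a r≈at) (conj-involutive a t)

    conj-swapʳ : ∀ a {r t} → conj a r ≈ t → r ≈ conj a t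
    conj-swapʳ a {r} {t} ar≈t = ≈-trans (≈-sym (conj-involutive a r)) (conj-cong a ar≈t)

    -- frame t x = x⁻¹ t x: the wall t as seen from the end of the gallery x.
    frame : Word k → Word k → Word k
    frame t [] = t
    frame t (a ∷ x) = frame (conj a t) x

    frame-≈ : ∀ t x → frame t x ≈ (reverse x ++ t ++ x)
    frame-≈ t [] = ≡⇒≈ (sym (ListP.++-identityʳ t))
    frame-≈ t (a ∷ x) = ≈-trans (frame-≈ (conj a t) x) (≡⇒≈ reassoc)
      where
      reassoc : reverse x ++ (a ∷ (t ++ a ∷ [])) ++ x ≡ reverse (a ∷ x) ++ t ++ a ∷ x
      reassoc = trans (cong (reverse x ++_) (cong (a ∷_) (ListP.++-assoc t (a ∷ []) x)))
                (trans (sym (ListP.++-assoc (reverse x) (a ∷ []) (t ++ a ∷ x))) (cong (_++ (t ++ a ∷ x)) (sym (ListP.unfold-reverse a x))))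

    reflectionOf : Word k → Fin k → Word k
    reflectionOf w s = w ++ s ∷ reverse w

    reflectionOf-++ : ∀ w s → (reflectionOf w s ++ w) ≈ (w ++ s ∷ [])
    reflectionOf-++ w s = ≈-trans (≡⇒≈ (ListP.++-assoc w (s ∷ reverse w) w)) (≈-congˡ w (≈-congˡ (s ∷ []) (reverse-++ w)))

    reflectionOf-++-s : ∀ w s → (reflectionOf w s ++ w ++ s ∷ []) ≈ w
    reflectionOf-++-s w s = ≈-trans (≡⇒≈ (sym (ListP.++-assoc (reflectionOf w s) w (s ∷ []))))
      (≈-trans (≈-congʳ (s ∷ []) (reflectionOf-++ w s)) (≈-trans (≡⇒≈ (ListP.++-assoc w (s ∷ []) (s ∷ []))) (≈-trans (≈-sq w [] s) (≡⇒≈ (ListP.++-identityʳ w)))))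

    frame-reflectionOf : ∀ w s → frame (reflectionOf w s) w ≈ (s ∷ [])
    frame-reflectionOf w s = ≈-trans (frame-≈ (reflectionOf w s) w) (≈-trans (≈-congˡ (reverse w) (reflectionOf-++ w s))
      (≈-trans (≡⇒≈ (sym (ListP.++-assoc (reverse w) w (s ∷ [])))) (≈-congʳ (s ∷ []) (reverse-++ w))))

module Windows where
  open import Data.Nat as ℕ using (ℕ; zero; suc)
  import Data.Nat.Properties as ℕP
  open import Data.Integer using (ℤ; +_; -_; _+_; _-_; _*_; 0ℤ; 1ℤ)
  import Data.Integer.Properties as ℤP
  open import Data.Integer.Tactic.RingSolver using (solve-∀)
  open import Data.Fin using (Fin; zero; suc; toℕ)
  import Data.Fin.Properties as FinP
  open import Data.Vec using (Vec; updateAt)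
  import Data.Vec.Properties as VecP
  open import Data.Sum using ([_,_]′)
  open import Function using (_∘_; id)
  open import Relation.Binary.PropositionalEquality
  open import Relation.Nullary using (yes; no)
  open import Algebra.Properties.Semiring.Sum ℤP.+-*-semiring public
    using (sum; sum-syntax; sum-cong-≗; ∑-distrib-+; ∑-comm; *-distribˡ-sum; *-distribʳ-sum; sum-replicate-zero)

  sum-neg : ∀ {n} (f : Fin n → ℤ) → ∑[ t < n ] (- f t) ≡ - sum f
  sum-neg {zero} f = refl
  sum-neg {suc n} f = trans (cong (_+_ (- f zero)) (sum-neg (f ∘ suc))) (sym (ℤP.neg-distrib-+ (f zero) _))

  sum-const : ∀ n c → ∑[ t < n ] c ≡ + n * c
  sum-const zero c = sym (ℤP.*-zeroˡ c)
  sum-const (suc n) c = trans (cong (_+_ c) (sum-const n c)) (factor c (+ n))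
    where factor : ∀ c n → c + n * c ≡ (1ℤ + n) * c
          factor = solve-∀

  sum-telescope : ∀ n (G : ℕ → ℤ) → ∑[ t < n ] (G (toℕ t) - G (suc (toℕ t))) ≡ G 0 - G n
  sum-telescope zero G = sym (ℤP.+-inverseʳ (G 0))
  sum-telescope (suc n) G =
    trans (cong (_+_ (G 0 - G 1)) (sum-telescope n (G ∘ suc))) (cancel (G 0) (G 1) (G (suc n)))
    where cancel : ∀ a b c → a - b + (b - c) ≡ a - c
          cancel = solve-∀

  Fun : ℕ → Set
  Fun N = Vec ℤ N → ℤ

  shift : ∀ {N} → Fin N → ℤ → Vec ℤ N → Vec ℤ N
  shift e d ι = updateAt ι e (_+ d)

  shift-shift : ∀ {N} (e : Fin N) a b ι → shift e a (shift e b ι) ≡ shift e (b + a) ι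
  shift-shift e a b ι = trans (VecP.updateAt-updateAt e ι) (VecP.updateAt-cong e (λ x → ℤP.+-assoc x b a) ι)

  shift-zero : ∀ {N} (e : Fin N) ι → shift e 0ℤ ι ≡ ι
  shift-zero e ι = trans (VecP.updateAt-cong e ℤP.+-identityʳ ι) (VecP.updateAt-id e ι)

  shift-comm : ∀ {N} (e e′ : Fin N) a b ι → shift e a (shift e′ b ι) ≡ shift e′ b (shift e a ι)
  shift-comm e e′ a b ι with e FinP.≟ e′
  ... | yes refl = trans (shift-shift e a b ι) (trans (cong (λ c → shift e c ι) (ℤP.+-comm b a)) (sym (shift-shift e b a ι)))
  ... | no e≢e′ = VecP.updateAt-commutes e e′ e≢e′ ι

  shift-inverseˡ : ∀ {N} (e : Fin N) ι → shift e 1ℤ (shift e (- 1ℤ) ι) ≡ ι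
  shift-inverseˡ e ι = trans (shift-shift e 1ℤ (- 1ℤ) ι) (shift-zero e ι)

  shift-inverseʳ : ∀ {N} (e : Fin N) ι → shift e (- 1ℤ) (shift e 1ℤ ι) ≡ ι
  shift-inverseʳ e ι = trans (shift-shift e (- 1ℤ) 1ℤ ι) (shift-zero e ι)

  windowPoint : ∀ {N n} → Fin N → (ℕ → ℤ) → Vec ℤ N → Fin n → Vec ℤ N
  windowPoint e ω ι t = shift e (ω (toℕ t)) ι

  window : ∀ {N} → Fin N → (ℕ → ℤ) → ℕ → Fun N → Fun N
  window e ω n f ι = sum {n} (f ∘ windowPoint e ω ι)

  forward backward : ℕ → ℤ
  forward t = + t
  backward t = - + t

  window⁺-suc : ∀ {N} (e : Fin N) q (z : Fun N) ι → window e forward (suc q) z ι ≡ z ι + window e forward q z (shift e 1ℤ ι)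
  window⁺-suc e q z ι = cong₂ _+_ (cong z (shift-zero e ι))
    (sum-cong-≗ {q} (λ t → cong z (trans (cong (λ d → shift e d ι) (ℤP.pos-+ 1 (toℕ t))) (sym (shift-shift e (+ toℕ t) 1ℤ ι)))))

  window⁻-suc : ∀ {N} (e : Fin N) q (z : Fun N) ι → window e backward (suc q) z ι ≡ z ι + window e backward q z (shift e (- 1ℤ) ι)
  window⁻-suc e q z ι = cong₂ _+_ (cong z (shift-zero e ι))
    (sum-cong-≗ {q} (λ t → cong z (trans (cong (λ d → shift e d ι) (offset (toℕ t))) (sym (shift-shift e (- + toℕ t) (- 1ℤ) ι)))))
    where offset : ∀ t → - + suc t ≡ - 1ℤ + - + t
          offset t = trans (cong -_ (ℤP.pos-+ 1 t)) (ℤP.neg-distrib-+ 1ℤ (+ t))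

  WindowsVanish : ∀ {N} → Fin N → (ℕ → ℤ) → ℕ → Fun N → Set
  WindowsVanish e ω n f = ∀ ι → window e ω n f ι ≡ 0ℤ

  record Balanced {N} (e : Fin N) (n : ℕ) (f : Fun N) : Set where
    constructor balanced
    field
      vanish⁺ : WindowsVanish e forward n f
      vanish⁻ : WindowsVanish e backward n f

  module _ {N : ℕ} (e : Fin N) (ω : ℕ → ℤ) (n : ℕ) where

    vanish-cong : ∀ {f g : Fun N} → (∀ ι → f ι ≡ g ι) → WindowsVanish e ω n f → WindowsVanish e ω n g
    vanish-cong f≗g vf ι = trans (sum-cong-≗ {n} (λ t → sym (f≗g _))) (vf ι)

    vanish-zero : WindowsVanish e ω n (λ _ → 0ℤ)
    vanish-zero ι = sum-replicate-zero n

    vanish-+ : ∀ {f g : Fun N} → WindowsVanish e ω n f → WindowsVanish e ω n g → WindowsVanish e ω n (λ ι → f ι + g ι)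
    vanish-+ {f} {g} vf vg ι = trans (∑-distrib-+ {n} (f ∘ windowPoint e ω ι) (g ∘ windowPoint e ω ι)) (cong₂ _+_ (vf ι) (vg ι))

    vanish-neg : ∀ {f : Fun N} → WindowsVanish e ω n f → WindowsVanish e ω n (λ ι → - f ι)
    vanish-neg {f} vf ι = trans (sum-neg {n} (f ∘ windowPoint e ω ι)) (cong -_ (vf ι))

    vanish-*ˡ : ∀ c {f : Fun N} → WindowsVanish e ω n f → WindowsVanish e ω n (λ ι → c * f ι)
    vanish-*ˡ c {f} vf ι = trans (sym (*-distribˡ-sum {n} c (f ∘ windowPoint e ω ι))) (trans (cong (c *_) (vf ι)) (ℤP.*-zeroʳ c))

    vanish-shift : ∀ e′ d {f : Fun N} → WindowsVanish e ω n f → WindowsVanish e ω n (f ∘ shift e′ d)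
    vanish-shift e′ d {f} vf ι = trans (sum-cong-≗ {n} (λ t → cong f (shift-comm e′ e d _ ι))) (vf (shift e′ d ι))

    vanish-sum : ∀ {k} (g : Fin k → Fun N) → (∀ r → WindowsVanish e ω n (g r)) → WindowsVanish e ω n (λ ι → ∑[ r < k ] g r ι)
    vanish-sum {k} g vg ι = trans (∑-comm {n} {k} (λ t r → g r (windowPoint e ω ι t))) (trans (sum-cong-≗ {k} (λ r → vg r ι)) (sum-replicate-zero k))

  module _ {N : ℕ} {e : Fin N} {n : ℕ} where

    balanced-cong : ∀ {f g : Fun N} → (∀ ι → f ι ≡ g ι) → Balanced e n f → Balanced e n g
    balanced-cong {f} {g} f≗g (balanced v⁺ v⁻) = balanced (vanish-cong e forward n {f} {g} f≗g v⁺) (vanish-cong e backward n {f} {g} f≗g v⁻)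

    balanced-zero : Balanced e n (λ _ → 0ℤ)
    balanced-zero = balanced (vanish-zero e forward n) (vanish-zero e backward n)

    balanced-+ : ∀ {f g : Fun N} → Balanced e n f → Balanced e n g → Balanced e n (λ ι → f ι + g ι)
    balanced-+ {f} {g} (balanced f⁺ f⁻) (balanced g⁺ g⁻) = balanced (vanish-+ e forward n {f} {g} f⁺ g⁺) (vanish-+ e backward n {f} {g} f⁻ g⁻)

    balanced-neg : ∀ {f : Fun N} → Balanced e n f → Balanced e n (λ ι → - f ι)
    balanced-neg {f} (balanced f⁺ f⁻) = balanced (vanish-neg e forward n {f} f⁺) (vanish-neg e backward n {f} f⁻)

    balanced-minus : ∀ {f g : Fun N} → Balanced e n f → Balanced e n g → Balanced e n (λ ι → f ι - g ι)
    balanced-minus bf bg = balanced-+ bf (balanced-neg bg)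

    balanced-*ˡ : ∀ c {f : Fun N} → Balanced e n f → Balanced e n (λ ι → c * f ι)
    balanced-*ˡ c {f} (balanced f⁺ f⁻) = balanced (vanish-*ˡ e forward n c {f} f⁺) (vanish-*ˡ e backward n c {f} f⁻)

    balanced-shift : ∀ e′ d {f : Fun N} → Balanced e n f → Balanced e n (f ∘ shift e′ d)
    balanced-shift e′ d {f} (balanced f⁺ f⁻) = balanced (vanish-shift e forward n e′ d {f} f⁺) (vanish-shift e backward n e′ d {f} f⁻)

    balanced-sum : ∀ {k} (g : Fin k → Fun N) → (∀ r → Balanced e n (g r)) → Balanced e n (λ ι → ∑[ r < k ] g r ι)
    balanced-sum g bg = balanced (vanish-sum e forward n g (λ r → Balanced.vanish⁺ (bg r))) (vanish-sum e backward n g (λ r → Balanced.vanish⁻ (bg r)))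

  Periodic : ℤ → (ℤ → ℤ) → Set
  Periodic p h = ∀ d → h (d + p) ≡ h d

  periodic-multiple : ∀ {p h} → Periodic p h → ∀ q → Periodic (+ q * p) h
  periodic-multiple {p} {h} per zero d = cong h (trans (cong (_+_ d) (ℤP.*-zeroˡ p)) (ℤP.+-identityʳ d))
  periodic-multiple {p} {h} per (suc q) d =
    trans (cong h (regroup d (+ q) p)) (trans (per (d + + q * p)) (periodic-multiple per q d))
    where regroup : ∀ d q p → d + (1ℤ + q) * p ≡ d + q * p + p
          regroup = solve-∀

  vanishing-windows⇒periodic : ∀ n (h : ℤ → ℤ) → (∀ d → ∑[ t < n ] h (d + + toℕ t) ≡ 0ℤ) → Periodic (+ n) h
  vanishing-windows⇒periodic n h windows d = begin
    h (d + + n)  ≡⟨ ℤP.i-j≡0⇒i≡j _ _ difference ⟨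
    h (d + 0ℤ)   ≡⟨ cong h (ℤP.+-identityʳ d) ⟩
    h d          ∎
    where
    open ≡-Reasoning
    G : ℕ → ℤ
    G t = h (d + + t)
    step : ∀ (t : Fin n) → d + + suc (toℕ t) ≡ d + 1ℤ + + toℕ t
    step t = trans (cong (_+_ d) (ℤP.pos-+ 1 (toℕ t))) (sym (ℤP.+-assoc d 1ℤ _))
    difference : G 0 - G n ≡ 0ℤ
    difference = begin
      G 0 - G n                                              ≡⟨ sum-telescope n G ⟨
      ∑[ t < n ] (G (toℕ t) - G (suc (toℕ t)))               ≡⟨ ∑-distrib-+ {n} (G ∘ toℕ) (λ t → - G (suc (toℕ t))) ⟩
      ∑[ t < n ] G (toℕ t) + ∑[ t < n ] (- G (suc (toℕ t)))  ≡⟨ cong₂ _+_ (windows d) (sum-neg {n} (λ t → G (suc (toℕ t)))) ⟩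
      0ℤ - ∑[ t < n ] G (suc (toℕ t))                        ≡⟨ cong (_-_ 0ℤ) (trans (sum-cong-≗ {n} (λ t → cong h (step t))) (windows (d + 1ℤ))) ⟩
      0ℤ                                                     ∎

  periodic-1⇒constant : ∀ {h} → Periodic 1ℤ h → ∀ t → h (+ t) ≡ h 0ℤ
  periodic-1⇒constant per zero = refl
  periodic-1⇒constant {h} per (suc t) =
    trans (cong h (trans (cong +_ (ℕP.+-comm 1 t)) (ℤP.pos-+ t 1))) (trans (per (+ t)) (periodic-1⇒constant per t))

  odd-periodic∧2-periodic⇒1-periodic : ∀ {h} r → Periodic (+ suc (r ℕ.+ r)) h → Periodic (+ 2) h → Periodic 1ℤ h
  odd-periodic∧2-periodic⇒1-periodic {h} r perₙ per₂ d = begin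
    h (d + 1ℤ)                  ≡⟨ periodic-multiple per₂ r (d + 1ℤ) ⟨
    h (d + 1ℤ + + r * + 2)      ≡⟨ cong h (regroup d (+ r)) ⟩
    h (d + (1ℤ + (+ r + + r)))  ≡⟨ cong (λ x → h (d + (1ℤ + x))) (ℤP.pos-+ r r) ⟨
    h (d + + suc (r ℕ.+ r))     ≡⟨ perₙ d ⟩
    h d                         ∎
    where
    open ≡-Reasoning
    regroup : ∀ d r → d + 1ℤ + r * + 2 ≡ d + (1ℤ + (r + r))
    regroup = solve-∀

  along : ∀ {N} → Fin N → Fun N → Vec ℤ N → ℤ → ℤ
  along e g ι d = g (shift e d ι)

  along-windows : ∀ {N} (e : Fin N) n (g : Fun N) → WindowsVanish e forward n g → ∀ ι d → ∑[ t < n ] along e g ι (d + + toℕ t) ≡ 0ℤ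
  along-windows e n g windows ι d = trans (sum-cong-≗ {n} (λ t → cong g (sym (shift-shift e (+ toℕ t) d ι)))) (windows (shift e d ι))

  along-2-periodic : ∀ {N} (e : Fin N) (g : Fun N) → (∀ ι → g (shift e 1ℤ ι) ≡ g (shift e (- 1ℤ) ι)) → ∀ ι → Periodic (+ 2) (along e g ι)
  along-2-periodic e g 2-periodic ι d = begin
    g (shift e (d + + 2) ι)                    ≡⟨ cong (along e g ι) (split d) ⟩
    g (shift e (d + 1ℤ + 1ℤ) ι)                ≡⟨ cong g (shift-shift e 1ℤ (d + 1ℤ) ι) ⟨
    g (shift e 1ℤ (shift e (d + 1ℤ) ι))        ≡⟨ 2-periodic (shift e (d + 1ℤ) ι) ⟩
    g (shift e (- 1ℤ) (shift e (d + 1ℤ) ι))    ≡⟨ cong g (shift-shift e (- 1ℤ) (d + 1ℤ) ι) ⟩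
    g (shift e (d + 1ℤ - 1ℤ) ι)                ≡⟨ cong (along e g ι) (cancel d) ⟩
    g (shift e d ι)                            ∎
    where
    open ≡-Reasoning
    split : ∀ d → d + + 2 ≡ d + 1ℤ + 1ℤ
    split = solve-∀
    cancel : ∀ d → d + 1ℤ - 1ℤ ≡ d
    cancel = solve-∀

  -- Restricted to a line along e, g is n-periodic (n odd) and 2-periodic, hence constant, and
  -- then its window sum n · g ι vanishes.
  balanced-2-periodic⇒zero : ∀ {N} (e : Fin N) r (g : Fun N) → WindowsVanish e forward (suc (r ℕ.+ r)) g →
                             (∀ ι → g (shift e 1ℤ ι) ≡ g (shift e (- 1ℤ) ι)) → ∀ ι → g ι ≡ 0ℤ
  balanced-2-periodic⇒zero e r g windows 2-periodic ι = begin
    g ι        ≡⟨ cong g (shift-zero e ι) ⟨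
    h 0ℤ       ≡⟨ [ (λ ()) , id ]′ (ℤP.i*j≡0⇒i≡0∨j≡0 (+ n) n*h₀≡0) ⟩
    0ℤ         ∎
    where
    open ≡-Reasoning
    n : ℕ
    n = suc (r ℕ.+ r)
    h : ℤ → ℤ
    h = along e g ι
    h-constant : ∀ t → h (+ t) ≡ h 0ℤ
    h-constant = periodic-1⇒constant (odd-periodic∧2-periodic⇒1-periodic r
                   (vanishing-windows⇒periodic n h (along-windows e n g windows ι)) (along-2-periodic e g 2-periodic ι))
    n*h₀≡0 : + n * h 0ℤ ≡ 0ℤ
    n*h₀≡0 = begin
      + n * h 0ℤ                  ≡⟨ sum-const n (h 0ℤ) ⟨
      ∑[ t < n ] h 0ℤ             ≡⟨ sum-cong-≗ {n} (λ t → trans (sym (h-constant (toℕ t))) (cong h (sym (ℤP.+-identityˡ (+ toℕ t))))) ⟩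
      ∑[ t < n ] h (0ℤ + + toℕ t) ≡⟨ along-windows e n g windows ι 0ℤ ⟩
      0ℤ                          ∎

module DihedralBlock where
  open Windows
  open import Data.Nat as ℕ using (ℕ; zero; suc)
  open import Data.Integer using (ℤ; +_; -_; _+_; _-_; _*_; 0ℤ; 1ℤ)
  import Data.Integer.Properties as ℤP
  open import Data.Integer.Tactic.RingSolver using (solve-∀)
  open import Data.Fin using (Fin)
  open import Data.Vec using (Vec)
  open import Data.Product using (_×_; _,_; proj₁; proj₂)
  open import Relation.Binary.Bundles using (Setoid)
  open import Relation.Binary.PropositionalEquality
  import Relation.Binary.Reasoning.Setoid as SetoidReasoning

  module OddBlock {N : ℕ} (e : Fin N) where

    T⁺ T⁻ : Vec ℤ N → Vec ℤ N
    T⁺ = shift e 1ℤ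
    T⁻ = shift e (- 1ℤ)

    -- On functions balanced for the window length n, the eigenvalues of T⁺ are the n-th roots
    -- of unity λ ≠ 1, on which this acts as 2 + λ + λ⁻¹ = 4 cos² (π j / n): it stands in for the
    -- entry 4 cos² (π / m) of the geometric representation.
    2+T+T⁻¹ : Fun N → Fun N
    2+T+T⁻¹ f ι = + 2 * f ι + f (T⁺ ι) + f (T⁻ ι)

    Fun² : Set
    Fun² = Fun N × Fun N

    infix 4 _≗²_
    _≗²_ : Fun² → Fun² → Set
    (x , y) ≗² (x′ , y′) = (∀ ι → x ι ≡ x′ ι) × (∀ ι → y ι ≡ y′ ι)

    ≗²-setoid : Setoid _ _
    ≗²-setoid = record
      { Carrier = Fun²
      ; _≈_ = _≗²_
      ; isEquivalence = record
        { refl = (λ ι → refl) , (λ ι → refl)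
        ; sym = λ (p , q) → (λ ι → sym (p ι)) , (λ ι → sym (q ι))
        ; trans = λ (p , q) (p′ , q′) → (λ ι → trans (p ι) (p′ ι)) , (λ ι → trans (q ι) (q′ ι))
        }
      }

    open Setoid ≗²-setoid public using () renaming (refl to ≗²-refl; trans to ≗²-trans)

    infixl 6 _⊕_ _⊖_
    _⊕_ _⊖_ : Fun² → Fun² → Fun²
    (x , y) ⊕ (x′ , y′) = (λ ι → x ι + x′ ι) , (λ ι → y ι + y′ ι)
    (x , y) ⊖ (x′ , y′) = (λ ι → x ι - x′ ι) , (λ ι → y ι - y′ ι)

    𝟘 : Fun²
    𝟘 = (λ _ → 0ℤ) , (λ _ → 0ℤ)

    ⊕-cong : ∀ {a b c d} → a ≗² b → c ≗² d → a ⊕ c ≗² b ⊕ d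
    ⊕-cong (p₁ , p₂) (q₁ , q₂) = (λ ι → cong₂ _+_ (p₁ ι) (q₁ ι)) , (λ ι → cong₂ _+_ (p₂ ι) (q₂ ι))

    ⊖-cong : ∀ {a b c d} → a ≗² b → c ≗² d → a ⊖ c ≗² b ⊖ d
    ⊖-cong (p₁ , p₂) (q₁ , q₂) = (λ ι → cong₂ _-_ (p₁ ι) (q₁ ι)) , (λ ι → cong₂ _-_ (p₂ ι) (q₂ ι))

    translate : ℤ → Fun² → Fun²
    translate d (x , y) = (λ ι → x (shift e d ι)) , (λ ι → y (shift e d ι))

    -- The linear part of s_i s_j acting on the (s_i, s_j)-coordinates of the representation.
    ρ : Fun² → Fun²
    ρ (x , y) = (λ ι → - x ι + 2+T+T⁻¹ (λ ι′ → x ι′ - y ι′) ι) , (λ ι → x ι - y ι)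

    ρ-cong : ∀ {a b} → a ≗² b → ρ a ≗² ρ b
    ρ-cong (p₁ , p₂) =
      (λ ι → cong₂ _+_ (cong -_ (p₁ ι)) (cong₂ _+_ (cong₂ _+_ (cong (+ 2 *_) (cong₂ _-_ (p₁ ι) (p₂ ι))) (cong₂ _-_ (p₁ _) (p₂ _))) (cong₂ _-_ (p₁ _) (p₂ _)))) ,
      (λ ι → cong₂ _-_ (p₁ ι) (p₂ ι))

    ρ-⊖ : ∀ a b → ρ (a ⊖ b) ≗² ρ a ⊖ ρ b
    ρ-⊖ (x , y) (x′ , y′) =
      (λ ι → linear (x ι) (y ι) (x′ ι) (y′ ι) (x (T⁺ ι)) (y (T⁺ ι)) (x′ (T⁺ ι)) (y′ (T⁺ ι)) (x (T⁻ ι)) (y (T⁻ ι)) (x′ (T⁻ ι)) (y′ (T⁻ ι))) ,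
      (λ ι → linear₂ (x ι) (y ι) (x′ ι) (y′ ι))
      where
      linear : ∀ a₁ a₂ b₁ b₂ c₁ c₂ d₁ d₂ e₁ e₂ f₁ f₂ →
        - (a₁ - b₁) + (+ 2 * ((a₁ - b₁) - (a₂ - b₂)) + ((c₁ - d₁) - (c₂ - d₂)) + ((e₁ - f₁) - (e₂ - f₂)))
        ≡ (- a₁ + (+ 2 * (a₁ - a₂) + (c₁ - c₂) + (e₁ - e₂))) - (- b₁ + (+ 2 * (b₁ - b₂) + (d₁ - d₂) + (f₁ - f₂)))
      linear = solve-∀
      linear₂ : ∀ a₁ a₂ b₁ b₂ → (a₁ - b₁) - (a₂ - b₂) ≡ (a₁ - a₂) - (b₁ - b₂)
      linear₂ = solve-∀

    ρ-translate : ∀ d w → ρ (translate d w) ≗² translate d (ρ w)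
    ρ-translate d w = first , (λ ι → refl)
      where
      first : ∀ ι → proj₁ (ρ (translate d w)) ι ≡ proj₁ (translate d (ρ w)) ι
      first ι rewrite shift-comm e e d 1ℤ ι | shift-comm e e d (- 1ℤ) ι = refl

    ρ-sum : ℕ → Fun² → Fun²
    ρ-sum zero d = 𝟘
    ρ-sum (suc q) d = d ⊕ ρ (ρ-sum q d)

    ρ-sum-cong : ∀ q {a b} → a ≗² b → ρ-sum q a ≗² ρ-sum q b
    ρ-sum-cong zero p = ≗²-refl
    ρ-sum-cong (suc q) p = ⊕-cong p (ρ-cong (ρ-sum-cong q p))

    ρ-sum-⊖ : ∀ q a b → ρ-sum q (a ⊖ b) ≗² ρ-sum q a ⊖ ρ-sum q b
    ρ-sum-⊖ zero a b = (λ ι → refl) , (λ ι → refl)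
    ρ-sum-⊖ (suc q) a b = begin
      (a ⊖ b) ⊕ ρ (ρ-sum q (a ⊖ b))                ≈⟨ ⊕-cong {a ⊖ b} ≗²-refl (ρ-cong (ρ-sum-⊖ q a b)) ⟩
      (a ⊖ b) ⊕ ρ (ρ-sum q a ⊖ ρ-sum q b)          ≈⟨ ⊕-cong {a ⊖ b} ≗²-refl (ρ-⊖ (ρ-sum q a) (ρ-sum q b)) ⟩
      (a ⊖ b) ⊕ (ρ (ρ-sum q a) ⊖ ρ (ρ-sum q b))    ≈⟨ (λ ι → regroup (proj₁ a ι) (proj₁ b ι) (proj₁ (ρ (ρ-sum q a)) ι) (proj₁ (ρ (ρ-sum q b)) ι)) ,
                                                      (λ ι → regroup (proj₂ a ι) (proj₂ b ι) (proj₂ (ρ (ρ-sum q a)) ι) (proj₂ (ρ (ρ-sum q b)) ι)) ⟩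
      ρ-sum (suc q) a ⊖ ρ-sum (suc q) b            ∎
      where
      open SetoidReasoning ≗²-setoid
      regroup : ∀ a b c d → (a - b) + (c - d) ≡ (a + c) - (b + d)
      regroup = solve-∀

    ρ-sum-translate : ∀ q d w → ρ-sum q (translate d w) ≗² translate d (ρ-sum q w)
    ρ-sum-translate zero d w = ≗²-refl
    ρ-sum-translate (suc q) d w = ⊕-cong {translate d w} ≗²-refl (≗²-trans (ρ-cong (ρ-sum-translate q d w)) (ρ-translate d (ρ-sum q w)))

    eigen⁺ eigen⁻ : Fun N → Fun²
    eigen⁺ z = (λ ι → z (T⁺ ι) + z ι) , z
    eigen⁻ z = (λ ι → z (T⁻ ι) + z ι) , z

    ρ-eigen⁺ : ∀ z → ρ (eigen⁺ z) ≗² translate 1ℤ (eigen⁺ z)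
    ρ-eigen⁺ z = first , (λ ι → cancel (z (T⁺ ι)) (z ι))
      where
      identity : ∀ a b c m → - (a + b) + (+ 2 * ((a + b) - b) + ((c + a) - a) + ((b + m) - m)) ≡ c + a
      identity = solve-∀
      cancel : ∀ a b → (a + b) - b ≡ a
      cancel = solve-∀
      first : ∀ ι → proj₁ (ρ (eigen⁺ z)) ι ≡ proj₁ (translate 1ℤ (eigen⁺ z)) ι
      first ι rewrite shift-inverseˡ e ι = identity (z (T⁺ ι)) (z ι) (z (T⁺ (T⁺ ι))) (z (T⁻ ι))

    ρ-eigen⁻ : ∀ z → ρ (eigen⁻ z) ≗² translate (- 1ℤ) (eigen⁻ z)
    ρ-eigen⁻ z = first , (λ ι → cancel (z (T⁻ ι)) (z ι))
      where
      identity : ∀ a b c m → - (a + b) + (+ 2 * ((a + b) - b) + ((b + m) - m) + ((c + a) - a)) ≡ c + a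
      identity = solve-∀
      cancel : ∀ a b → (a + b) - b ≡ a
      cancel = solve-∀
      first : ∀ ι → proj₁ (ρ (eigen⁻ z)) ι ≡ proj₁ (translate (- 1ℤ) (eigen⁻ z)) ι
      first ι rewrite shift-inverseʳ e ι = identity (z (T⁻ ι)) (z ι) (z (T⁻ (T⁻ ι))) (z (T⁺ ι))

    ρ-sum-eigen⁺ : ∀ q z → ρ-sum q (eigen⁺ z) ≗² eigen⁺ (window e forward q z)
    ρ-sum-eigen⁺ zero z = (λ ι → refl) , (λ ι → refl)
    ρ-sum-eigen⁺ (suc q) z = begin
      eigen⁺ z ⊕ ρ (ρ-sum q (eigen⁺ z))               ≈⟨ ⊕-cong {eigen⁺ z} ≗²-refl (ρ-cong (ρ-sum-eigen⁺ q z)) ⟩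
      eigen⁺ z ⊕ ρ (eigen⁺ W)                         ≈⟨ ⊕-cong {eigen⁺ z} ≗²-refl (ρ-eigen⁺ W) ⟩
      eigen⁺ z ⊕ translate 1ℤ (eigen⁺ W)              ≈⟨ (λ ι → trans (regroup (z (T⁺ ι)) (z ι) (W (T⁺ (T⁺ ι))) (W (T⁺ ι)))
                                                                   (sym (cong₂ _+_ (window⁺-suc e q z (T⁺ ι)) (window⁺-suc e q z ι)))) ,
                                                         (λ ι → sym (window⁺-suc e q z ι)) ⟩
      eigen⁺ (window e forward (suc q) z)             ∎
      where
      open SetoidReasoning ≗²-setoid
      W : Fun N
      W = window e forward q z
      regroup : ∀ a b c d → (a + b) + (c + d) ≡ (a + c) + (b + d)
      regroup = solve-∀

    ρ-sum-eigen⁻ : ∀ q z → ρ-sum q (eigen⁻ z) ≗² eigen⁻ (window e backward q z)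
    ρ-sum-eigen⁻ zero z = (λ ι → refl) , (λ ι → refl)
    ρ-sum-eigen⁻ (suc q) z = begin
      eigen⁻ z ⊕ ρ (ρ-sum q (eigen⁻ z))               ≈⟨ ⊕-cong {eigen⁻ z} ≗²-refl (ρ-cong (ρ-sum-eigen⁻ q z)) ⟩
      eigen⁻ z ⊕ ρ (eigen⁻ W)                         ≈⟨ ⊕-cong {eigen⁻ z} ≗²-refl (ρ-eigen⁻ W) ⟩
      eigen⁻ z ⊕ translate (- 1ℤ) (eigen⁻ W)          ≈⟨ (λ ι → trans (regroup (z (T⁻ ι)) (z ι) (W (T⁻ (T⁻ ι))) (W (T⁻ ι)))
                                                                   (sym (cong₂ _+_ (window⁻-suc e q z (T⁻ ι)) (window⁻-suc e q z ι)))) ,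
                                                         (λ ι → sym (window⁻-suc e q z ι)) ⟩
      eigen⁻ (window e backward (suc q) z)            ∎
      where
      open SetoidReasoning ≗²-setoid
      W : Fun N
      W = window e backward q z
      regroup : ∀ a b c d → (a + b) + (c + d) ≡ (a + c) + (b + d)
      regroup = solve-∀

    translate-difference : ∀ d → translate 1ℤ d ⊖ translate (- 1ℤ) d ≗²
      eigen⁺ (λ ι → proj₁ d ι - proj₂ d ι - proj₂ d (T⁻ ι)) ⊖ eigen⁻ (λ ι → proj₁ d ι - proj₂ d ι - proj₂ d (T⁺ ι))
    translate-difference (x , y) = first , (λ ι → identity₂ (x ι) (y (T⁺ ι)) (y ι) (y (T⁻ ι)))
      where
      identity : ∀ a₁ a₀ aₘ b₁ b₀ bₘ → a₁ - aₘ ≡ ((a₁ - b₁ - b₀) + (a₀ - b₀ - bₘ)) - ((aₘ - bₘ - b₀) + (a₀ - b₀ - b₁))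
      identity = solve-∀
      identity₂ : ∀ a₀ b₁ b₀ bₘ → b₁ - bₘ ≡ (a₀ - b₀ - bₘ) - (a₀ - b₀ - b₁)
      identity₂ = solve-∀
      first : ∀ ι → x (T⁺ ι) - x (T⁻ ι) ≡ proj₁ (eigen⁺ (λ ι → x ι - y ι - y (T⁻ ι)) ⊖ eigen⁻ (λ ι → x ι - y ι - y (T⁺ ι))) ι
      first ι rewrite shift-inverseʳ e ι | shift-inverseˡ e ι = identity (x (T⁺ ι)) (x ι) (x (T⁻ ι)) (y (T⁺ ι)) (y ι) (y (T⁻ ι))

    module OddWindow (r : ℕ) where
      n : ℕ
      n = suc (r ℕ.+ r)

      Balanced² : Fun² → Set
      Balanced² (x , y) = Balanced e n x × Balanced e n y

      balanced-2+T+T⁻¹ : ∀ {f} → Balanced e n f → Balanced e n (2+T+T⁻¹ f)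
      balanced-2+T+T⁻¹ bf = balanced-+ (balanced-+ (balanced-*ˡ (+ 2) bf) (balanced-shift e 1ℤ bf)) (balanced-shift e (- 1ℤ) bf)

      balanced-⊕ : ∀ {a b} → Balanced² a → Balanced² b → Balanced² (a ⊕ b)
      balanced-⊕ (a₁ , a₂) (b₁ , b₂) = balanced-+ a₁ b₁ , balanced-+ a₂ b₂

      balanced-⊖ : ∀ {a b} → Balanced² a → Balanced² b → Balanced² (a ⊖ b)
      balanced-⊖ (a₁ , a₂) (b₁ , b₂) = balanced-minus a₁ b₁ , balanced-minus a₂ b₂

      balanced-ρ : ∀ {a} → Balanced² a → Balanced² (ρ a)
      balanced-ρ (b₁ , b₂) = balanced-+ (balanced-neg b₁) (balanced-2+T+T⁻¹ (balanced-minus b₁ b₂)) , balanced-minus b₁ b₂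

      balanced-ρ-sum : ∀ q {a} → Balanced² a → Balanced² (ρ-sum q a)
      balanced-ρ-sum zero b = balanced-zero , balanced-zero
      balanced-ρ-sum (suc q) b = balanced-⊕ b (balanced-ρ (balanced-ρ-sum q b))

      -- T⁺ - T⁻ commutes with ρ-sum n and splits d into eigenvectors of ρ, on which ρ-sum n
      -- produces window sums, which vanish; and T⁺ - T⁻ is injective on balanced functions.
      ρ-sum-balanced : ∀ d → Balanced² d → ρ-sum n d ≗² 𝟘
      ρ-sum-balanced d@(x , y) bd@(bx , by) =
        balanced-2-periodic⇒zero e r (proj₁ g) (Balanced.vanish⁺ (proj₁ bg)) (λ ι → ℤP.i-j≡0⇒i≡j _ _ (proj₁ difference ι)) ,
        balanced-2-periodic⇒zero e r (proj₂ g) (Balanced.vanish⁺ (proj₂ bg)) (λ ι → ℤP.i-j≡0⇒i≡j _ _ (proj₂ difference ι))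
        where
        open SetoidReasoning ≗²-setoid
        z⁺ z⁻ : Fun N
        z⁺ ι = x ι - y ι - y (T⁻ ι)
        z⁻ ι = x ι - y ι - y (T⁺ ι)
        bz⁺ : Balanced e n z⁺
        bz⁺ = balanced-minus (balanced-minus bx by) (balanced-shift e (- 1ℤ) by)
        bz⁻ : Balanced e n z⁻
        bz⁻ = balanced-minus (balanced-minus bx by) (balanced-shift e 1ℤ by)
        g : Fun²
        g = ρ-sum n d
        bg : Balanced² g
        bg = balanced-ρ-sum n bd
        difference : translate 1ℤ g ⊖ translate (- 1ℤ) g ≗² 𝟘
        difference = begin
          translate 1ℤ g ⊖ translate (- 1ℤ) g                               ≈⟨ ⊖-cong (ρ-sum-translate n 1ℤ d) (ρ-sum-translate n (- 1ℤ) d) ⟨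
          ρ-sum n (translate 1ℤ d) ⊖ ρ-sum n (translate (- 1ℤ) d)           ≈⟨ ρ-sum-⊖ n (translate 1ℤ d) (translate (- 1ℤ) d) ⟨
          ρ-sum n (translate 1ℤ d ⊖ translate (- 1ℤ) d)                     ≈⟨ ρ-sum-cong n (translate-difference d) ⟩
          ρ-sum n (eigen⁺ z⁺ ⊖ eigen⁻ z⁻)                                   ≈⟨ ρ-sum-⊖ n (eigen⁺ z⁺) (eigen⁻ z⁻) ⟩
          ρ-sum n (eigen⁺ z⁺) ⊖ ρ-sum n (eigen⁻ z⁻)                         ≈⟨ ⊖-cong (ρ-sum-eigen⁺ n z⁺) (ρ-sum-eigen⁻ n z⁻) ⟩
          eigen⁺ (window e forward n z⁺) ⊖ eigen⁻ (window e backward n z⁻)  ≈⟨ (λ ι → cong₂ _-_ (cong₂ _+_ (w⁺ (T⁺ ι)) (w⁺ ι))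
                                                                                                   (cong₂ _+_ (w⁻ (T⁻ ι)) (w⁻ ι))) ,
                                                                               (λ ι → cong₂ _-_ (w⁺ ι) (w⁻ ι)) ⟩
          𝟘                                                                 ∎
          where
          w⁺ : WindowsVanish e forward n z⁺
          w⁺ = Balanced.vanish⁺ bz⁺
          w⁻ : WindowsVanish e backward n z⁻
          w⁻ = Balanced.vanish⁻ bz⁻

      -- s_i s_j restricted to the (s_i, s_j)-coordinates, the other coordinates contributing the constants c₁, c₂.
      module Affine (c₁ c₂ : Fun N) where
        τ : Fun² → Fun²
        τ (x , y) = (λ ι → - x ι + 2+T+T⁻¹ (λ ι′ → - y ι′ + x ι′ + c₂ ι′) ι + c₁ ι) , (λ ι → - y ι + x ι + c₂ ι)

        τ^ : ℕ → Fun² → Fun²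
        τ^ zero w = w
        τ^ (suc q) w = τ (τ^ q w)

        τ-⊖ : ∀ a b → τ a ⊖ τ b ≗² ρ (a ⊖ b)
        τ-⊖ (x , y) (x′ , y′) =
          (λ ι → identity (x ι) (y ι) (x′ ι) (y′ ι) (x (T⁺ ι)) (y (T⁺ ι)) (x′ (T⁺ ι)) (y′ (T⁺ ι))
                          (x (T⁻ ι)) (y (T⁻ ι)) (x′ (T⁻ ι)) (y′ (T⁻ ι)) (c₂ ι) (c₂ (T⁺ ι)) (c₂ (T⁻ ι)) (c₁ ι)) ,
          (λ ι → identity₂ (x ι) (y ι) (x′ ι) (y′ ι) (c₂ ι))
          where
          identity : ∀ a₁ a₂ b₁ b₂ c₁ c₂ d₁ d₂ e₁ e₂ f₁ f₂ y₀ y₁ y₂ x₀ →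
              (- a₁ + (+ 2 * (- a₂ + a₁ + y₀) + (- c₂ + c₁ + y₁) + (- e₂ + e₁ + y₂)) + x₀)
            - (- b₁ + (+ 2 * (- b₂ + b₁ + y₀) + (- d₂ + d₁ + y₁) + (- f₂ + f₁ + y₂)) + x₀)
            ≡ - (a₁ - b₁) + (+ 2 * ((a₁ - b₁) - (a₂ - b₂)) + ((c₁ - d₁) - (c₂ - d₂)) + ((e₁ - f₁) - (e₂ - f₂)))
          identity = solve-∀
          identity₂ : ∀ a₁ a₂ b₁ b₂ y₀ → (- a₂ + a₁ + y₀) - (- b₂ + b₁ + y₀) ≡ (a₁ - b₁) - (a₂ - b₂)
          identity₂ = solve-∀

        τ^-⊖ : ∀ q w → τ^ q w ⊖ w ≗² ρ-sum q (τ w ⊖ w)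
        τ^-⊖ zero (x , y) = (λ ι → ℤP.+-inverseʳ (x ι)) , (λ ι → ℤP.+-inverseʳ (y ι))
        τ^-⊖ (suc q) w = begin
          τ (τ^ q w) ⊖ w                          ≈⟨ (λ ι → split (proj₁ (τ (τ^ q w)) ι) (proj₁ (τ w) ι) (proj₁ w ι)) ,
                                                     (λ ι → split (proj₂ (τ (τ^ q w)) ι) (proj₂ (τ w) ι) (proj₂ w ι)) ⟩
          (τ (τ^ q w) ⊖ τ w) ⊕ (τ w ⊖ w)          ≈⟨ ⊕-cong (≗²-trans (τ-⊖ (τ^ q w) w) (ρ-cong (τ^-⊖ q w))) (≗²-refl {τ w ⊖ w}) ⟩
          ρ (ρ-sum q d) ⊕ d                       ≈⟨ (λ ι → ℤP.+-comm (proj₁ (ρ (ρ-sum q d)) ι) (proj₁ d ι)) ,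
                                                     (λ ι → ℤP.+-comm (proj₂ (ρ (ρ-sum q d)) ι) (proj₂ d ι)) ⟩
          ρ-sum (suc q) d                         ∎
          where
          open SetoidReasoning ≗²-setoid
          d : Fun²
          d = τ w ⊖ w
          split : ∀ a b c → a - c ≡ (a - b) + (b - c)
          split = solve-∀

        balanced-τ : Balanced e n c₁ → Balanced e n c₂ → ∀ {w} → Balanced² w → Balanced² (τ w)
        balanced-τ b₁ b₂ (bx , by) = balanced-+ (balanced-+ (balanced-neg bx) (balanced-2+T+T⁻¹ b′)) b₁ , b′
          where b′ = balanced-+ (balanced-+ (balanced-neg by) bx) b₂

        τ^n≗id : Balanced e n c₁ → Balanced e n c₂ → ∀ w → Balanced² w → τ^ n w ≗² w
        τ^n≗id b₁ b₂ w bw = (λ ι → ℤP.i-j≡0⇒i≡j _ _ (proj₁ vanishes ι)) , (λ ι → ℤP.i-j≡0⇒i≡j _ _ (proj₂ vanishes ι))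
          where
          vanishes : τ^ n w ⊖ w ≗² 𝟘
          vanishes = ≗²-trans (τ^-⊖ n w) (ρ-sum-balanced (τ w ⊖ w) (balanced-⊖ (balanced-τ b₁ b₂ bw) bw))

module IntegerRepresentation where
  open import Defs hiding (_≈⟨_⟩_)
  open Windows
  open DihedralBlock
  open CoxeterWords using (alt-suc-cons; alt-suc-snoc; module Words)
  open import Data.Nat as ℕ using (ℕ; zero; suc)
  import Data.Nat.Properties as ℕP
  open import Data.Integer using (ℤ; +_; -_; _+_; _*_; 0ℤ; 1ℤ)
  import Data.Integer.Properties as ℤP
  open import Data.Integer.Tactic.RingSolver using (solve-∀)
  open import Data.Fin as Fin using (Fin; zero; suc; combine; _<?_)
  import Data.Fin.Properties as FinP
  open import Data.List using ([]; _∷_; _++_)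
  open import Data.Bool using (Bool; true; false; not; if_then_else_)
  open import Data.Maybe using (just; nothing)
  open import Data.Product using (Σ; _×_; _,_; proj₁; proj₂)
  open import Data.Sum using (_⊎_; inj₁; inj₂)
  open import Data.Empty using (⊥-elim)
  open import Function using (_∘_)
  open import Relation.Binary.Bundles using (Setoid)
  open import Relation.Binary.PropositionalEquality
  import Relation.Binary.Reasoning.Setoid as SetoidReasoning
  open import Relation.Binary.Definitions using (tri<; tri≈; tri>)
  open import Relation.Nullary using (Dec; yes; no; does; ¬_)
  open import Relation.Nullary.Decidable using (dec-true; dec-false)

  isOdd : ℕ → Bool
  isOdd zero = false
  isOdd (suc n) = not (isOdd n)

  even-or-odd : ∀ n → (isOdd n ≡ false × Σ ℕ (λ r → n ≡ r ℕ.+ r)) ⊎ (isOdd n ≡ true × Σ ℕ (λ r → n ≡ suc (r ℕ.+ r)))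
  even-or-odd zero = inj₁ (refl , 0 , refl)
  even-or-odd (suc n) with even-or-odd n
  ... | inj₁ (even , r , refl) rewrite even = inj₂ (refl , r , refl)
  ... | inj₂ (odd , r , refl) rewrite odd = inj₁ (refl , suc r , cong suc (sym (ℕP.+-suc r r)))

  if-yes : ∀ {P A : Set} (d : Dec P) {a b : A} → P → (if does d then a else b) ≡ a
  if-yes d p = cong (if_then _ else _) (dec-true d p)

  if-no : ∀ {P A : Set} (d : Dec P) {a b : A} → ¬ P → (if does d then a else b) ≡ b
  if-no d ¬p = cong (if_then _ else _) (dec-false d ¬p)

  neg-cancel : ∀ a c → - (- a + c) + c ≡ a
  neg-cancel = solve-∀

  omit : ∀ {k} → Fin k → Fin k → ℤ → ℤ
  omit p r z = if does (r FinP.≟ p) then 0ℤ else z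

  sum-omit : ∀ {k} (p : Fin k) (g : Fin k → ℤ) → ∑[ r < k ] g r ≡ g p + ∑[ r < k ] omit p r (g r)
  sum-omit {suc k} zero g = cong (_+_ (g zero)) (sym (ℤP.+-identityˡ (sum {k} (g ∘ suc))))
  sum-omit {suc k} (suc p) g =
    trans (cong (_+_ (g zero)) (sum-omit p (g ∘ suc))) (swap (g zero) (g (suc p)) (∑[ r < k ] omit p r (g (suc r))))
    where swap : ∀ a b c → a + (b + c) ≡ b + (a + c)
          swap = solve-∀

  -- If m l p is even or ∞ they are made to commute: this represents
  -- a quotient of W, which is enough to tell generators apart. If m l p is odd they interact
  -- through the coefficients 2+T+T⁻¹ (l < p) and 1 (l > p), whose product stands in for
  -- 4 cos² (π / m l p).
  data Coupling : Set where
    uncoupled coupled< coupled> : Coupling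

  module Representation {k : ℕ} (m : CoxMatrix k) (cox : IsCoxeterMatrix m) where
    open Words m using (_≈_)

    -- Each pair (l, p) has its own lattice axis, along which its coefficient translates.
    K : ℕ
    K = k ℕ.* k

    axis : Fin k → Fin k → Fin K
    axis = combine

    Vect : Set
    Vect = Fin k → Fun K

    m-sym : ∀ {i j n} → m i j ≡ just n → m j i ≡ just n
    m-sym {i} {j} mᵢⱼ = trans (sym (proj₁ cox i j)) mᵢⱼ

    coupling : Fin k → Fin k → Coupling
    coupling l p with l FinP.≟ p | m l p
    ... | yes _ | _ = uncoupled
    ... | no _ | nothing = uncoupled
    ... | no _ | just n with isOdd n | l <? p
    ...   | false | _ = uncoupled
    ...   | true | yes _ = coupled<
    ...   | true | no _ = coupled>

    coupling-diag : ∀ l → coupling l l ≡ uncoupled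
    coupling-diag l with l FinP.≟ l
    ... | yes _ = refl
    ... | no l≢l = ⊥-elim (l≢l refl)

    coupling-even : ∀ {l p n} → l ≢ p → m l p ≡ just n → isOdd n ≡ false → coupling l p ≡ uncoupled
    coupling-even {l} {p} l≢p mₗₚ even with l FinP.≟ p
    ... | yes l≡p = ⊥-elim (l≢p l≡p)
    ... | no _ rewrite mₗₚ | even = refl

    coupling-< : ∀ {l p n} → l Fin.< p → m l p ≡ just n → isOdd n ≡ true → coupling l p ≡ coupled<
    coupling-< {l} {p} l<p mₗₚ odd with l FinP.≟ p
    ... | yes l≡p = ⊥-elim (FinP.<⇒≢ l<p l≡p)
    ... | no _ rewrite mₗₚ | odd with l <? p
    ...   | yes _ = refl
    ...   | no l≮p = ⊥-elim (l≮p l<p)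

    coupling-> : ∀ {l p n} → p Fin.< l → m l p ≡ just n → isOdd n ≡ true → coupling l p ≡ coupled>
    coupling-> {l} {p} p<l mₗₚ odd with l FinP.≟ p
    ... | yes l≡p = ⊥-elim (FinP.<⇒≢ p<l (sym l≡p))
    ... | no _ rewrite mₗₚ | odd with l <? p
    ...   | yes l<p = ⊥-elim (FinP.<-asym l<p p<l)
    ...   | no _ = refl

    coefficient : Coupling → Fin K → Fun K → Fun K
    coefficient uncoupled e f ι = 0ℤ
    coefficient coupled< e f = OddBlock.2+T+T⁻¹ e f
    coefficient coupled> e f = f

    cartan : Fin k → Fin k → Fun K → Fun K
    cartan l p = coefficient (coupling l p) (axis l p)

    cartan-coupled< : ∀ l p f ι → coupling l p ≡ coupled< → cartan l p f ι ≡ OddBlock.2+T+T⁻¹ (axis l p) f ι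
    cartan-coupled< l p f ι eq rewrite eq = refl

    cartan-coupled> : ∀ l p f ι → coupling l p ≡ coupled> → cartan l p f ι ≡ f ι
    cartan-coupled> l p f ι eq rewrite eq = refl

    coefficient-cong : ∀ c e {f g : Fun K} → (∀ ι → f ι ≡ g ι) → ∀ ι → coefficient c e f ι ≡ coefficient c e g ι
    coefficient-cong uncoupled e f≗g ι = refl
    coefficient-cong coupled< e f≗g ι = cong₂ _+_ (cong₂ _+_ (cong (+ 2 *_) (f≗g ι)) (f≗g _)) (f≗g _)
    coefficient-cong coupled> e f≗g ι = f≗g ι

    coefficient-zero : ∀ c e ι → coefficient c e (λ _ → 0ℤ) ι ≡ 0ℤ
    coefficient-zero uncoupled e ι = refl
    coefficient-zero coupled< e ι = refl
    coefficient-zero coupled> e ι = refl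

    adjacent : Fin k → Vect → Fun K
    adjacent l v ι = ∑[ r < k ] cartan l r (v r) ι

    adjacent-without : Fin k → Fin k → Vect → Fun K
    adjacent-without l p v ι = ∑[ r < k ] omit p r (cartan l r (v r) ι)

    adjacent-split : ∀ l p v ι → adjacent l v ι ≡ cartan l p (v p) ι + adjacent-without l p v ι
    adjacent-split l p v ι = sum-omit p (λ r → cartan l r (v r) ι)

    infix 4 _≋_
    _≋_ : Vect → Vect → Set
    v ≋ v′ = ∀ q ι → v q ι ≡ v′ q ι

    ≋-refl : ∀ {v} → v ≋ v
    ≋-refl q ι = refl

    ≋-sym : ∀ {v v′} → v ≋ v′ → v′ ≋ v
    ≋-sym v≋v′ q ι = sym (v≋v′ q ι)

    ≋-trans : ∀ {v v′ v″} → v ≋ v′ → v′ ≋ v″ → v ≋ v″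
    ≋-trans v≋v′ v′≋v″ q ι = trans (v≋v′ q ι) (v′≋v″ q ι)

    ≡⇒≋ : ∀ {v v′} → v ≡ v′ → v ≋ v′
    ≡⇒≋ refl = ≋-refl

    ≋-setoid : Setoid _ _
    ≋-setoid = record { Carrier = Vect ; _≈_ = _≋_ ; isEquivalence = record { refl = ≋-refl ; sym = ≋-sym ; trans = ≋-trans } }

    AgreeOff : Fin k → Fin k → Vect → Vect → Set
    AgreeOff l p v v′ = ∀ r → r ≢ l → r ≢ p → ∀ ι → v r ι ≡ v′ r ι

    adjacent-cong : ∀ l {v v′} → v ≋ v′ → ∀ ι → adjacent l v ι ≡ adjacent l v′ ι
    adjacent-cong l v≋v′ ι = sum-cong-≗ (λ r → coefficient-cong (coupling l r) (axis l r) (v≋v′ r) ι)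

    adjacent-uncoupled : ∀ l p {v v′} → coupling l p ≡ uncoupled → AgreeOff l p v v′ → ∀ ι → adjacent l v ι ≡ adjacent l v′ ι
    adjacent-uncoupled l p {v} {v′} uncoupled-lp agree ι = sum-cong-≗ term
      where
      term : ∀ r → cartan l r (v r) ι ≡ cartan l r (v′ r) ι
      term r with r FinP.≟ l | r FinP.≟ p
      ... | yes refl | _ rewrite coupling-diag r = refl
      ... | no _ | yes refl rewrite uncoupled-lp = refl
      ... | no r≢l | no r≢p = coefficient-cong (coupling l r) (axis l r) (agree r r≢l r≢p) ι

    adjacent-without-cong : ∀ l p {v v′} → AgreeOff l p v v′ → ∀ ι → adjacent-without l p v ι ≡ adjacent-without l p v′ ι
    adjacent-without-cong l p {v} {v′} agree ι = sum-cong-≗ term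
      where
      term : ∀ r → omit p r (cartan l r (v r) ι) ≡ omit p r (cartan l r (v′ r) ι)
      term r with r FinP.≟ l | r FinP.≟ p
      ... | _ | yes refl = refl
      ... | yes refl | no _ rewrite coupling-diag r = refl
      ... | no r≢l | no r≢p = coefficient-cong (coupling l r) (axis l r) (agree r r≢l r≢p) ι

    -- The contragredient of the geometric representation.
    abstract
      reflect : Fin k → Vect → Vect
      reflect l v q ι = if does (q FinP.≟ l) then - v l ι + adjacent l v ι else v q ι

      reflect-here : ∀ l v ι → reflect l v l ι ≡ - v l ι + adjacent l v ι
      reflect-here l v ι = if-yes (l FinP.≟ l) refl

      reflect-other : ∀ l v q ι → q ≢ l → reflect l v q ι ≡ v q ι
      reflect-other l v q ι q≢l = if-no (q FinP.≟ l) q≢l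

    act : Word k → Vect → Vect
    act [] v = v
    act (a ∷ u) v = reflect a (act u v)

    reflect-cong : ∀ l {v v′} → v ≋ v′ → reflect l v ≋ reflect l v′
    reflect-cong l {v} {v′} v≋v′ q ι with q FinP.≟ l
    ... | yes refl = trans (reflect-here q v ι) (trans (cong₂ _+_ (cong -_ (v≋v′ q ι)) (adjacent-cong q v≋v′ ι)) (sym (reflect-here q v′ ι)))
    ... | no q≢l = trans (reflect-other l v q ι q≢l) (trans (v≋v′ q ι) (sym (reflect-other l v′ q ι q≢l)))

    act-cong : ∀ u {v v′} → v ≋ v′ → act u v ≋ act u v′
    act-cong [] v≋v′ = v≋v′
    act-cong (a ∷ u) v≋v′ = reflect-cong a (act-cong u v≋v′)

    act-++ : ∀ u w v → act (u ++ w) v ≡ act u (act w v)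
    act-++ [] w v = refl
    act-++ (a ∷ u) w v = cong (reflect a) (act-++ u w v)

    reflect-involutive : ∀ l v → reflect l (reflect l v) ≋ v
    reflect-involutive l v q ι with q FinP.≟ l
    ... | yes refl = trans (reflect-here q (reflect q v) ι) (trans (cong₂ _+_ (cong -_ (reflect-here q v ι))
          (adjacent-uncoupled q q (coupling-diag q) (λ r r≢q _ ι → reflect-other q v r ι r≢q) ι)) (neg-cancel (v q ι) (adjacent q v ι)))
    ... | no q≢l = trans (reflect-other l (reflect l v) q ι q≢l) (reflect-other l v q ι q≢l)

    -- The representation is only built on the subspace of functions balanced along every
    -- axis carrying a coupling, where the odd braid relations hold.
    Admissible : Fun K → Set
    Admissible f = ∀ l p n → l Fin.< p → m l p ≡ just n → isOdd n ≡ true → Balanced (axis l p) n f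

    AdmissibleVect : Vect → Set
    AdmissibleVect v = ∀ q → Admissible (v q)

    admissible-cong : ∀ {f g} → (∀ ι → f ι ≡ g ι) → Admissible f → Admissible g
    admissible-cong f≗g af l p n l<p mₗₚ odd = balanced-cong f≗g (af l p n l<p mₗₚ odd)

    admissible-zero : Admissible (λ _ → 0ℤ)
    admissible-zero l p n l<p mₗₚ odd = balanced-zero

    admissible-+ : ∀ {f g} → Admissible f → Admissible g → Admissible (λ ι → f ι + g ι)
    admissible-+ af ag l p n l<p mₗₚ odd = balanced-+ (af l p n l<p mₗₚ odd) (ag l p n l<p mₗₚ odd)

    admissible-neg : ∀ {f} → Admissible f → Admissible (λ ι → - f ι)
    admissible-neg af l p n l<p mₗₚ odd = balanced-neg (af l p n l<p mₗₚ odd)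

    admissible-*ˡ : ∀ c {f} → Admissible f → Admissible (λ ι → c * f ι)
    admissible-*ˡ c af l p n l<p mₗₚ odd = balanced-*ˡ c (af l p n l<p mₗₚ odd)

    admissible-shift : ∀ e d {f} → Admissible f → Admissible (f ∘ shift e d)
    admissible-shift e d af l p n l<p mₗₚ odd = balanced-shift e d (af l p n l<p mₗₚ odd)

    admissible-sum : (g : Fin k → Fun K) → (∀ r → Admissible (g r)) → Admissible (λ ι → ∑[ r < k ] g r ι)
    admissible-sum g ag l p n l<p mₗₚ odd = balanced-sum g (λ r → ag r l p n l<p mₗₚ odd)

    admissible-coefficient : ∀ c e {f} → Admissible f → Admissible (coefficient c e f)
    admissible-coefficient uncoupled e af = admissible-zero
    admissible-coefficient coupled< e af =
      admissible-+ (admissible-+ (admissible-*ˡ (+ 2) af) (admissible-shift e 1ℤ af)) (admissible-shift e (- 1ℤ) af)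
    admissible-coefficient coupled> e af = af

    admissible-adjacent : ∀ l {v} → AdmissibleVect v → Admissible (adjacent l v)
    admissible-adjacent l {v} av = admissible-sum (λ r → cartan l r (v r)) (λ r → admissible-coefficient (coupling l r) (axis l r) (av r))

    admissible-adjacent-without : ∀ l p {v} → AdmissibleVect v → Admissible (adjacent-without l p v)
    admissible-adjacent-without l p {v} av = admissible-sum (λ r ι → omit p r (cartan l r (v r) ι)) term
      where
      term : ∀ r → Admissible (λ ι → omit p r (cartan l r (v r) ι))
      term r with r FinP.≟ p
      ... | yes _ = admissible-zero
      ... | no _ = admissible-coefficient (coupling l r) (axis l r) (av r)

    admissible-reflect : ∀ l {v} → AdmissibleVect v → AdmissibleVect (reflect l v)
    admissible-reflect l {v} av q with q FinP.≟ l
    ... | yes refl = admissible-cong (λ ι → sym (reflect-here q v ι)) (admissible-+ (admissible-neg (av q)) (admissible-adjacent q av))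
    ... | no q≢l = admissible-cong (λ ι → sym (reflect-other l v q ι q≢l)) (av q)

    admissible-act : ∀ u {v} → AdmissibleVect v → AdmissibleVect (act u v)
    admissible-act [] av = av
    admissible-act (a ∷ u) av = admissible-reflect a (admissible-act u av)

    module EvenBraid (i j : Fin k) (i≢j : i ≢ j) (uᵢⱼ : coupling i j ≡ uncoupled) (uⱼᵢ : coupling j i ≡ uncoupled) where

      T : Vect → Vect
      T v = reflect i (reflect j v)

      T-i : ∀ v ι → T v i ι ≡ - v i ι + adjacent i v ι
      T-i v ι = trans (reflect-here i (reflect j v) ι) (cong₂ _+_ (cong -_ (reflect-other j v i ι i≢j))
                  (adjacent-uncoupled i j uᵢⱼ (λ r _ r≢j ι → reflect-other j v r ι r≢j) ι))

      T-j : ∀ v ι → T v j ι ≡ - v j ι + adjacent j v ι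
      T-j v ι = trans (reflect-other i (reflect j v) j ι (i≢j ∘ sym)) (reflect-here j v ι)

      T-other : ∀ v q ι → q ≢ i → q ≢ j → T v q ι ≡ v q ι
      T-other v q ι q≢i q≢j = trans (reflect-other i (reflect j v) q ι q≢i) (reflect-other j v q ι q≢j)

      T-involutive : ∀ v → T (T v) ≋ v
      T-involutive v q ι with q FinP.≟ i | q FinP.≟ j
      ... | yes refl | _ = trans (T-i (T v) ι) (trans (cong₂ _+_ (cong -_ (T-i v ι))
            (adjacent-uncoupled i j uᵢⱼ (λ r r≢i r≢j ι → T-other v r ι r≢i r≢j) ι)) (neg-cancel (v i ι) (adjacent i v ι)))
      ... | no _ | yes refl = trans (T-j (T v) ι) (trans (cong₂ _+_ (cong -_ (T-j v ι))
            (adjacent-uncoupled j i uⱼᵢ (λ r r≢j r≢i ι → T-other v r ι r≢i r≢j) ι)) (neg-cancel (v j ι) (adjacent j v ι)))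
      ... | no q≢i | no q≢j = trans (T-other (T v) q ι q≢i q≢j) (T-other v q ι q≢i q≢j)

      braid-even : ∀ r v → act (alt i j (r ℕ.+ r)) v ≋ v
      braid-even zero v = ≋-refl
      braid-even (suc r) v rewrite ℕP.+-suc r r = ≋-trans (T-involutive (act (alt i j (r ℕ.+ r)) v)) (braid-even r v)

    module OddBraid (i j : Fin k) (r : ℕ) (i<j : i Fin.< j) (mᵢⱼ : m i j ≡ just (suc (r ℕ.+ r))) (odd : isOdd (suc (r ℕ.+ r)) ≡ true) where
      n : ℕ
      n = suc (r ℕ.+ r)

      i≢j : i ≢ j
      i≢j = FinP.<⇒≢ i<j

      coupled-ij : coupling i j ≡ coupled<
      coupled-ij = coupling-< i<j mᵢⱼ odd

      coupled-ji : coupling j i ≡ coupled>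
      coupled-ji = coupling-> i<j (m-sym mᵢⱼ) odd

      open OddBlock (axis i j) using (2+T+T⁻¹; Fun²; _≗²_)
      open OddBlock.OddWindow (axis i j) r using (module Affine)

      module _ (v : Vect) (av : AdmissibleVect v) where
        c₁ c₂ : Fun K
        c₁ = adjacent-without i j v
        c₂ = adjacent-without j i v

        open Affine c₁ c₂

        TrackedBy : Vect → Fun² → Set
        TrackedBy u (x , y) = (∀ ι → u i ι ≡ x ι) × (∀ ι → u j ι ≡ y ι) × AgreeOff i j u v

        reflect-j-tracked : ∀ {u x y} → TrackedBy u (x , y) → ∀ ι → reflect j u j ι ≡ - y ι + x ι + c₂ ι
        reflect-j-tracked {u} {x} {y} (uᵢ , uⱼ , agree) ι = begin
          reflect j u j ι                                      ≡⟨ reflect-here j u ι ⟩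
          - u j ι + adjacent j u ι                             ≡⟨ cong (_+_ (- u j ι)) (adjacent-split j i u ι) ⟩
          - u j ι + (cartan j i (u i) ι + adjacent-without j i u ι)  ≡⟨ cong (λ a → - u j ι + (a + adjacent-without j i u ι)) (cartan-coupled> j i (u i) ι coupled-ji) ⟩
          - u j ι + (u i ι + adjacent-without j i u ι)          ≡⟨ cong₂ (λ a b → - a + b) (uⱼ ι)
                                                                      (cong₂ _+_ (uᵢ ι) (adjacent-without-cong j i (λ q q≢j q≢i → agree q q≢i q≢j) ι)) ⟩
          - y ι + (x ι + c₂ ι)                                 ≡⟨ ℤP.+-assoc (- y ι) (x ι) (c₂ ι) ⟨
          - y ι + x ι + c₂ ι                                   ∎
          where open ≡-Reasoning

        reflect-ij-tracked : ∀ {u w} → TrackedBy u w → TrackedBy (reflect i (reflect j u)) (τ w)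
        reflect-ij-tracked {u} {x , y} tracked@(uᵢ , uⱼ , agree) = first , second , others
          where
          open ≡-Reasoning
          u′ : Vect
          u′ = reflect j u
          agree′ : AgreeOff i j u′ v
          agree′ q q≢i q≢j ι = trans (reflect-other j u q ι q≢j) (agree q q≢i q≢j ι)
          first : ∀ ι → reflect i u′ i ι ≡ proj₁ (τ (x , y)) ι
          first ι = begin
            reflect i u′ i ι                                          ≡⟨ reflect-here i u′ ι ⟩
            - u′ i ι + adjacent i u′ ι                                ≡⟨ cong₂ _+_ (cong -_ (trans (reflect-other j u i ι i≢j) (uᵢ ι))) (adjacent-split i j u′ ι) ⟩
            - x ι + (cartan i j (u′ j) ι + adjacent-without i j u′ ι)       ≡⟨ cong (λ a → - x ι + (a + adjacent-without i j u′ ι)) (cartan-coupled< i j (u′ j) ι coupled-ij) ⟩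
            - x ι + (2+T+T⁻¹ (u′ j) ι + adjacent-without i j u′ ι)     ≡⟨ cong (_+_ (- x ι)) (cong₂ _+_ (coefficient-cong coupled< (axis i j) (reflect-j-tracked tracked) ι)
                                                                                                      (adjacent-without-cong i j agree′ ι)) ⟩
            - x ι + (2+T+T⁻¹ (λ ι′ → - y ι′ + x ι′ + c₂ ι′) ι + c₁ ι) ≡⟨ ℤP.+-assoc (- x ι) _ (c₁ ι) ⟨
            proj₁ (τ (x , y)) ι                                      ∎
          second : ∀ ι → reflect i u′ j ι ≡ - y ι + x ι + c₂ ι
          second ι = trans (reflect-other i u′ j ι (i≢j ∘ sym)) (reflect-j-tracked tracked ι)
          others : AgreeOff i j (reflect i u′) v
          others q q≢i q≢j ι = trans (reflect-other i u′ q ι q≢i) (agree′ q q≢i q≢j ι)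

        alt-tracked : ∀ q → TrackedBy (act (alt i j q) v) (τ^ q (v i , v j))
        alt-tracked zero = (λ ι → refl) , (λ ι → refl) , (λ q _ _ ι → refl)
        alt-tracked (suc q) = reflect-ij-tracked (alt-tracked q)

        τ^n-fixes : τ^ n (v i , v j) ≗² (v i , v j)
        τ^n-fixes = τ^n≗id (admissible-adjacent-without i j av i j n i<j mᵢⱼ odd) (admissible-adjacent-without j i av i j n i<j mᵢⱼ odd)
                           (v i , v j) (av i i j n i<j mᵢⱼ odd , av j i j n i<j mᵢⱼ odd)

        braid-odd : act (alt i j n) v ≋ v
        braid-odd q ι with q FinP.≟ i | q FinP.≟ j
        ... | yes refl | _ = trans (proj₁ (alt-tracked n) ι) (proj₁ τ^n-fixes ι)
        ... | no _ | yes refl = trans (proj₁ (proj₂ (alt-tracked n)) ι) (proj₂ τ^n-fixes ι)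
        ... | no q≢i | no q≢j = proj₂ (proj₂ (alt-tracked n)) q q≢i q≢j ι

    -- (s_i s_j)ⁿ⁺¹ is conjugate to (s_j s_i)ⁿ⁺¹ by s_i.
    braid-swap : ∀ i j n → (∀ v → AdmissibleVect v → act (alt j i (suc n)) v ≋ v) → ∀ v → AdmissibleVect v → act (alt i j (suc n)) v ≋ v
    braid-swap i j n braid-ji v av = begin
      act (alt i j (suc n)) v                                       ≡⟨ cong (λ u → act u v) (alt-suc-cons i j n) ⟩
      reflect i (act (alt j i n ++ j ∷ []) v)                       ≡⟨ cong (reflect i) (act-++ (alt j i n) (j ∷ []) v) ⟩
      reflect i (act (alt j i n) (reflect j v))                     ≈⟨ reflect-cong i (act-cong (alt j i n) (reflect-cong j (≋-sym (reflect-involutive i v)))) ⟩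
      reflect i (act (alt j i n) (act (j ∷ i ∷ []) (reflect i v)))  ≡⟨ cong (reflect i) (act-++ (alt j i n) (j ∷ i ∷ []) (reflect i v)) ⟨
      reflect i (act (alt j i n ++ j ∷ i ∷ []) (reflect i v))       ≡⟨ cong (λ u → reflect i (act u (reflect i v))) (alt-suc-snoc j i n) ⟨
      reflect i (act (alt j i (suc n)) (reflect i v))               ≈⟨ reflect-cong i (braid-ji (reflect i v) (admissible-reflect i av)) ⟩
      reflect i (reflect i v)                                       ≈⟨ reflect-involutive i v ⟩
      v                                                             ∎
      where open SetoidReasoning ≋-setoid

    braid : ∀ i j n → i ≢ j → m i j ≡ just n → ∀ v → AdmissibleVect v → act (alt i j n) v ≋ v
    braid i j n i≢j mᵢⱼ v av with even-or-odd n
    ... | inj₁ (even , r , refl) =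
      EvenBraid.braid-even i j i≢j (coupling-even i≢j mᵢⱼ even) (coupling-even (i≢j ∘ sym) (m-sym mᵢⱼ) even) r v
    ... | inj₂ (odd , r , refl) with FinP.<-cmp i j
    ...   | tri< i<j _ _ = OddBraid.braid-odd i j r i<j mᵢⱼ odd v av
    ...   | tri≈ _ i≡j _ = ⊥-elim (i≢j i≡j)
    ...   | tri> _ _ j<i = braid-swap i j (r ℕ.+ r) (OddBraid.braid-odd j i r j<i (m-sym mᵢⱼ) odd) v av

    act-respects : ∀ {u w} → u ≈ w → ∀ v → AdmissibleVect v → act u v ≋ act w v
    act-respects ≈-refl v av = ≋-refl
    act-respects (≈-sym u≈w) v av = ≋-sym (act-respects u≈w v av)
    act-respects (≈-trans u≈w w≈x) v av = ≋-trans (act-respects u≈w v av) (act-respects w≈x v av)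
    act-respects (≈-sq u w i) v av =
      ≋-trans (≡⇒≋ (act-++ u (i ∷ i ∷ w) v)) (≋-trans (act-cong u (reflect-involutive i (act w v))) (≡⇒≋ (sym (act-++ u w v))))
    act-respects (≈-braid u w i j n i≢j mᵢⱼ) v av =
      ≋-trans (≡⇒≋ (trans (act-++ u (alt i j n ++ w) v) (cong (act u) (act-++ (alt i j n) w v))))
      (≋-trans (act-cong u (braid i j n i≢j mᵢⱼ (act w v) (admissible-act w av))) (≡⇒≋ (sym (act-++ u w v))))

module GeneratorsDistinct where
  open import Defs
  open Windows
  open IntegerRepresentation
  open import Data.Nat as ℕ using (ℕ; zero; suc; s≤s; z≤n)
  import Data.Nat.Properties as ℕP
  import Data.Nat.Divisibility as ℕ∣
  open import Data.Integer using (ℤ; +_; -_; _+_; _-_; _*_; 0ℤ; 1ℤ)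
  import Data.Integer.Properties as ℤP
  open import Data.Integer.Divisibility.Signed using (_∣_; _∣?_; divides; ∣m∣n⇒∣m+n; ∣m+n∣n⇒∣m; ∣-refl; ∣⇒∣ᵤ)
  open import Data.Integer.Tactic.RingSolver using (solve-∀)
  open import Data.Fin as Fin using (Fin; zero; suc; toℕ; remQuot; _<?_)
  import Data.Fin.Properties as FinP
  open import Data.Vec using (Vec; []; _∷_; lookup; tabulate; replicate)
  import Data.Vec.Properties as VecP
  open import Data.List using ([]; _∷_)
  open import Data.Bool using (true; false; if_then_else_)
  open import Data.Maybe using (just; nothing; maybe′)
  import Data.Maybe.Properties as MaybeP
  open import Data.Product using (_,_; proj₂; uncurry)
  open import Data.Sum using (inj₁; inj₂)
  open import Function using (_∘_; const)
  open import Relation.Binary.PropositionalEquality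
  open import Relation.Nullary using (Dec; yes; no; does)

  ⊗ : ∀ {N} → Vec (ℤ → ℤ) N → Fun N
  ⊗ [] [] = 1ℤ
  ⊗ (u ∷ us) (x ∷ ι) = u x * ⊗ us ι

  ⊗-vanish : ∀ {N} (us : Vec (ℤ → ℤ) N) e ω n → (∀ d → ∑[ t < n ] lookup us e (d + ω (toℕ t)) ≡ 0ℤ) →
             WindowsVanish e ω n (⊗ us)
  ⊗-vanish (u ∷ us) zero ω n windows (x ∷ ι) =
    trans (sym (*-distribʳ-sum {n} (⊗ us ι) (λ t → u (x + ω (toℕ t))))) (trans (cong (_* ⊗ us ι) (windows x)) (ℤP.*-zeroˡ (⊗ us ι)))
  ⊗-vanish (u ∷ us) (suc e) ω n windows (x ∷ ι) =
    trans (sym (*-distribˡ-sum {n} (u x) (λ t → ⊗ us (windowPoint e ω ι t)))) (trans (cong (u x *_) (⊗-vanish us e ω n windows ι)) (ℤP.*-zeroʳ (u x)))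

  ⊗-origin : ∀ {N} (us : Vec (ℤ → ℤ) N) → (∀ e → lookup us e 0ℤ ≡ 1ℤ) → ⊗ us (replicate N 0ℤ) ≡ 1ℤ
  ⊗-origin [] one = refl
  ⊗-origin (u ∷ us) one rewrite one zero | ⊗-origin us (one ∘ suc) = refl

  divisible-by : ℕ → ℤ → ℤ
  divisible-by N x = if does (+ N ∣? x) then 1ℤ else 0ℤ

  divisible-by-periodic : ∀ N → Periodic (+ N) (divisible-by N)
  divisible-by-periodic N x = by-cases (+ N ∣? x)
    where
    by-cases : Dec (+ N ∣ x) → divisible-by N (x + + N) ≡ divisible-by N x
    by-cases (yes N∣x) = trans (if-yes (+ N ∣? (x + + N)) (∣m∣n⇒∣m+n N∣x ∣-refl)) (sym (if-yes (+ N ∣? x) N∣x))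
    by-cases (no N∤x) = trans (if-no (+ N ∣? (x + + N)) (λ N∣x+N → N∤x (∣m+n∣n⇒∣m N∣x+N ∣-refl))) (sym (if-no (+ N ∣? x) N∤x))

  divisible-by-zero : ∀ N → divisible-by N 0ℤ ≡ 1ℤ
  divisible-by-zero N = if-yes (+ N ∣? 0ℤ) (divides 0ℤ refl)

  divisible-by-one : ∀ N → 2 ℕ.≤ N → divisible-by N 1ℤ ≡ 0ℤ
  divisible-by-one N 2≤N = if-no (+ N ∣? 1ℤ) λ N∣1 → ℕP.<⇒≢ 2≤N (sym (ℕ∣.∣1⇒≡1 (∣⇒∣ᵤ N∣1)))

  -- A function of period n whose windows of length n sum to zero, taking the value 1 at 0.
  -- For n < 2 it is never evaluated on a coupled axis, so it is just set to 1.
  φ : ℕ → ℤ → ℤ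
  φ (suc (suc n)) x = divisible-by (suc (suc n)) x - divisible-by (suc (suc n)) (x + 1ℤ)
  φ _ x = 1ℤ

  φ-origin : ∀ n → φ n 0ℤ ≡ 1ℤ
  φ-origin zero = refl
  φ-origin (suc zero) = refl
  φ-origin (suc (suc n)) = cong₂ _-_ (divisible-by-zero (suc (suc n))) (divisible-by-one (suc (suc n)) (s≤s (s≤s z≤n)))

  telescope-periodic : ∀ n (G : ℕ → ℤ) → G n ≡ G 0 → ∑[ t < n ] (G (toℕ t) - G (suc (toℕ t))) ≡ 0ℤ
  telescope-periodic n G Gₙ≡G₀ = trans (sum-telescope n G) (trans (cong (_-_ (G 0)) Gₙ≡G₀) (ℤP.+-inverseʳ (G 0)))

  φ-window⁺ : ∀ {n} → 2 ℕ.≤ n → ∀ d → ∑[ t < n ] φ n (d + + toℕ t) ≡ 0ℤ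
  φ-window⁺ {suc zero} (s≤s ()) d
  φ-window⁺ {suc (suc n)} _ d = trans (sum-cong-≗ {N} (λ t → cong (λ x → G (toℕ t) - divisible-by N x) (step (toℕ t))))
                                      (telescope-periodic N G (trans (divisible-by-periodic N d) (cong (divisible-by N) (sym (ℤP.+-identityʳ d)))))
    where
    N : ℕ
    N = suc (suc n)
    G : ℕ → ℤ
    G t = divisible-by N (d + + t)
    step : ∀ t → d + + t + 1ℤ ≡ d + + suc t
    step t = trans (ℤP.+-assoc d (+ t) 1ℤ) (cong (_+_ d) (trans (ℤP.+-comm (+ t) 1ℤ) (sym (ℤP.pos-+ 1 t))))

  φ-window⁻ : ∀ {n} → 2 ℕ.≤ n → ∀ d → ∑[ t < n ] φ n (d + - + toℕ t) ≡ 0ℤ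
  φ-window⁻ {suc zero} (s≤s ()) d
  φ-window⁻ {suc (suc n)} _ d = begin
    ∑[ t < N ] φ N (d + - + toℕ t)                          ≡⟨ sum-cong-≗ {N} (λ t → term (toℕ t)) ⟩
    ∑[ t < N ] (- (G (toℕ t) - G (suc (toℕ t))))            ≡⟨ sum-neg {N} (λ t → G (toℕ t) - G (suc (toℕ t))) ⟩
    - ∑[ t < N ] (G (toℕ t) - G (suc (toℕ t)))              ≡⟨ cong -_ (telescope-periodic N G Gₙ≡G₀) ⟩
    0ℤ                                                      ∎
    where
    open ≡-Reasoning
    N : ℕ
    N = suc (suc n)
    G : ℕ → ℤ
    G t = divisible-by N (d + 1ℤ + - + t)
    term : ∀ t → φ N (d + - + t) ≡ - (G t - G (suc t))
    term t = trans (cong₂ _-_ (cong (divisible-by N) (trans (shift₁ d (+ t)) (cong (λ x → d + 1ℤ + - x) (sym (ℤP.pos-+ 1 t)))))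
                              (cong (divisible-by N) (shift₂ d (+ t))))
                   (antisym (G (suc t)) (G t))
      where
      shift₁ : ∀ d t → d + - t ≡ d + 1ℤ + - (1ℤ + t)
      shift₁ = solve-∀
      shift₂ : ∀ d t → d + - t + 1ℤ ≡ d + 1ℤ + - t
      shift₂ = solve-∀
      antisym : ∀ a b → a - b ≡ - (b - a)
      antisym = solve-∀
    Gₙ≡G₀ : G N ≡ G 0
    Gₙ≡G₀ = trans (sym (divisible-by-periodic N (d + 1ℤ + - + N))) (cong (divisible-by N) (cancel (d + 1ℤ) (+ N)))
      where cancel : ∀ a b → a + - b + b ≡ a + - (+ 0)
            cancel = solve-∀

  module Distinct {k : ℕ} (m : CoxMatrix k) (cox : IsCoxeterMatrix m) where
    open Representation m cox

    coxeter-≥2 : ∀ {l p n} → l ≢ p → m l p ≡ just n → 2 ℕ.≤ n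
    coxeter-≥2 {l} {p} l≢p mₗₚ with proj₂ cox l p l≢p
    ... | inj₁ m≡∞ with () ← trans (sym mₗₚ) m≡∞
    ... | inj₂ (n′ , mₗₚ′ , 2≤n′) = subst (2 ℕ.≤_) (MaybeP.just-injective (trans (sym mₗₚ′) mₗₚ)) 2≤n′

    axisFunction : Fin k → Fin k → ℤ → ℤ
    axisFunction l p = if does (l <? p) then maybe′ φ (const 1ℤ) (m l p) else const 1ℤ

    axisFunctions : Vec (ℤ → ℤ) K
    axisFunctions = tabulate (uncurry axisFunction ∘ remQuot k)

    lookup-axisFunctions : ∀ l p → lookup axisFunctions (axis l p) ≡ axisFunction l p
    lookup-axisFunctions l p =
      trans (VecP.lookup∘tabulate (uncurry axisFunction ∘ remQuot k) (axis l p)) (cong (uncurry axisFunction) (FinP.remQuot-combine l p))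

    axisFunction-origin : ∀ l p → axisFunction l p 0ℤ ≡ 1ℤ
    axisFunction-origin l p with does (l <? p) | m l p
    ... | true | just n = φ-origin n
    ... | true | nothing = refl
    ... | false | _ = refl

    testFun : Fun K
    testFun = ⊗ axisFunctions

    origin : Vec ℤ K
    origin = replicate K 0ℤ

    testFun-origin : testFun origin ≡ 1ℤ
    testFun-origin = ⊗-origin axisFunctions one
      where
      one : ∀ e → lookup axisFunctions e 0ℤ ≡ 1ℤ
      one e = trans (cong (λ u → u 0ℤ) (VecP.lookup∘tabulate (uncurry axisFunction ∘ remQuot k) e)) (uncurry axisFunction-origin (remQuot k e))

    testFun-admissible : Admissible testFun
    testFun-admissible l p n l<p mₗₚ odd =
      balanced (⊗-vanish axisFunctions (axis l p) forward n (λ d → trans (sum-cong-≗ {n} (λ t → axis-is-φ (d + + toℕ t))) (φ-window⁺ 2≤n d)))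
               (⊗-vanish axisFunctions (axis l p) backward n (λ d → trans (sum-cong-≗ {n} (λ t → axis-is-φ (d + - + toℕ t))) (φ-window⁻ 2≤n d)))
      where
      2≤n : 2 ℕ.≤ n
      2≤n = coxeter-≥2 (FinP.<⇒≢ l<p) mₗₚ
      axis-is-φ : ∀ x → lookup axisFunctions (axis l p) x ≡ φ n x
      axis-is-φ x rewrite lookup-axisFunctions l p | if-yes (l <? p) {a = maybe′ φ (const 1ℤ) (m l p)} {b = const 1ℤ} l<p | mₗₚ = refl

    -- testFun in the a-th coordinate, which s_a negates at the origin and every other generator fixes.
    point : Fin k → Vect
    point a q ι = if does (q FinP.≟ a) then testFun ι else 0ℤ

    point-admissible : ∀ a → AdmissibleVect (point a)
    point-admissible a q with q FinP.≟ a
    ... | yes _ = testFun-admissible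
    ... | no _ = admissible-zero

    adjacent-point : ∀ a → adjacent a (point a) origin ≡ 0ℤ
    adjacent-point a = trans (sum-cong-≗ term) (sum-replicate-zero k)
      where
      term : ∀ r → cartan a r (point a r) origin ≡ 0ℤ
      term r with r FinP.≟ a
      ... | yes refl rewrite coupling-diag r = refl
      ... | no _ = coefficient-zero (coupling a r) (axis a r) origin

    point-origin : ∀ a → point a a origin ≡ 1ℤ
    point-origin a = trans (if-yes (a FinP.≟ a) refl) testFun-origin

    equal-reflections⇒-1≡1 : ∀ {a a′} → a ≢ a′ → (a ∷ []) ≈⟨ m ⟩ (a′ ∷ []) → - 1ℤ + 0ℤ ≡ 1ℤ
    equal-reflections⇒-1≡1 {a} {a′} a≢a′ a≈a′ = begin
      - 1ℤ + 0ℤ                                        ≡⟨ cong₂ _+_ (cong -_ (point-origin a)) (adjacent-point a) ⟨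
      - point a a origin + adjacent a (point a) origin ≡⟨ reflect-here a (point a) origin ⟨
      reflect a (point a) a origin                     ≡⟨ act-respects a≈a′ (point a) (point-admissible a) a origin ⟩
      reflect a′ (point a) a origin                    ≡⟨ reflect-other a′ (point a) a origin a≢a′ ⟩
      point a a origin                                 ≡⟨ point-origin a ⟩
      1ℤ                                               ∎
      where open ≡-Reasoning

    generators-distinct : ∀ a a′ → (a ∷ []) ≈⟨ m ⟩ (a′ ∷ []) → a ≡ a′
    generators-distinct a a′ a≈a′ with a FinP.≟ a′
    ... | yes a≡a′ = a≡a′
    ... | no a≢a′ with () ← equal-reflections⇒-1≡1 a≢a′ a≈a′

module Crossings where
  open import Defs
  open CoxeterWords
  open import Data.Nat as ℕ using (ℕ; zero; suc)
  import Data.Nat.Properties as ℕP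
  open import Data.Fin using (Fin)
  open import Data.List using (List; []; _∷_; _++_; length; map)
  import Data.List.Properties as ListP
  open import Data.List.Relation.Binary.Pointwise using (Pointwise; []; _∷_)
  open import Data.Bool using (Bool; true; false; _xor_)
  import Data.Bool.Properties as BoolP
  open import Data.Maybe using (just)
  open import Data.Product using (Σ; _×_; _,_)
  open import Function using (_∘′_)
  open import Relation.Binary.PropositionalEquality
  open import Relation.Nullary using (¬_; does; proof; Reflects; ofʸ; ofⁿ)
  open import Relation.Nullary.Decidable using (decidable-stable; ¬¬-excluded-middle)
  import Relation.Nullary.Reflects as Reflects

  reflects-⇔ : ∀ {P Q : Set} {b} → (P → Q) → (Q → P) → Reflects P b → Reflects Q b
  reflects-⇔ P⇒Q Q⇒P (ofʸ p) = ofʸ (P⇒Q p)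
  reflects-⇔ P⇒Q Q⇒P (ofⁿ ¬p) = ofⁿ (¬p ∘′ Q⇒P)

  ¬¬-reflects : ∀ (P : Set) → ¬ ¬ Σ Bool (Reflects P)
  ¬¬-reflects P ¬r = ¬¬-excluded-middle (λ P? → ¬r (does P? , proof P?))

  xor-cancelˡ : ∀ c b → c xor (c xor b) ≡ b
  xor-cancelˡ c b = trans (sym (BoolP.xor-assoc c c b)) (cong (_xor b) (BoolP.xor-same c))

  module CrossingParity {k : ℕ} (m : CoxMatrix k) where
    open Words m

    -- Crossings t x b: b is the parity of the number of positions i at which the gallery
    -- x = x₁ ⋯ xₙ crosses the wall of the reflection t, i.e. x₁ ⋯ xᵢ₋₁ xᵢ xᵢ₋₁ ⋯ x₁ ≈ t.
    -- Equality in W is not decidable, so this is a relation rather than a function.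
    data Crossings : Word k → Word k → Bool → Set where
      done : ∀ {t} → Crossings t [] false
      step : ∀ {t a x c b} → Reflects ((a ∷ []) ≈ t) c → Crossings (conj a t) x b → Crossings t (a ∷ x) (c xor b)

    crossings-unique : ∀ {t x b b′} → Crossings t x b → Crossings t x b′ → b ≡ b′
    crossings-unique done done = refl
    crossings-unique (step r x) (step r′ x′) = cong₂ _xor_ (Reflects.det r r′) (crossings-unique x x′)

    crossings-cong : ∀ {t t′ x b} → t ≈ t′ → Crossings t x b → Crossings t′ x b
    crossings-cong t≈t′ done = done
    crossings-cong {x = a ∷ _} t≈t′ (step r rest) =
      step (reflects-⇔ (λ a≈t → ≈-trans a≈t t≈t′) (λ a≈t′ → ≈-trans a≈t′ (≈-sym t≈t′)) r) (crossings-cong (conj-cong a t≈t′) rest)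

    ¬¬-crossings : ∀ t x → ¬ ¬ Σ Bool (Crossings t x)
    ¬¬-crossings t [] ¬c = ¬c (false , done)
    ¬¬-crossings t (a ∷ x) ¬c =
      ¬¬-reflects ((a ∷ []) ≈ t) (λ (c , r) → ¬¬-crossings (conj a t) x (λ (b , rest) → ¬c (c xor b , step r rest)))

    crossings-++ : ∀ {t x y b₁ b₂} → Crossings t x b₁ → Crossings (frame t x) y b₂ → Crossings t (x ++ y) (b₁ xor b₂)
    crossings-++ done y = y
    crossings-++ {b₂ = b₂} (step {c = c} {b = b} r x) y = subst (Crossings _ _) (sym (BoolP.xor-assoc c b b₂)) (step r (crossings-++ x y))

    crossings-split : ∀ {t} x {y b} → Crossings t (x ++ y) b →
      Σ Bool λ b₁ → Σ Bool λ b₂ → Crossings t x b₁ × Crossings (frame t x) y b₂ × b ≡ b₁ xor b₂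
    crossings-split [] xy = false , _ , done , xy , refl
    crossings-split (a ∷ x) (step {c = c} r xy) with crossings-split x xy
    ... | b₁ , b₂ , cx , cy , refl = c xor b₁ , b₂ , step r cx , cy , sym (BoolP.xor-assoc c b₁ b₂)

    -- The reflections x₁ ⋯ xᵢ ⋯ x₁ met by the gallery x, and the parity of the number of them equal to t.
    reflections : Word k → List (Word k)
    reflections [] = []
    reflections (a ∷ x) = (a ∷ []) ∷ map (conj a) (reflections x)

    data Occurrences (t : Word k) : List (Word k) → Bool → Set where
      done : Occurrences t [] false
      step : ∀ {r rs c b} → Reflects (r ≈ t) c → Occurrences t rs b → Occurrences t (r ∷ rs) (c xor b)

    occurrences-unique : ∀ {t rs b b′} → Occurrences t rs b → Occurrences t rs b′ → b ≡ b′
    occurrences-unique done done = refl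
    occurrences-unique (step r o) (step r′ o′) = cong₂ _xor_ (Reflects.det r r′) (occurrences-unique o o′)

    occurrences-conj : ∀ a {t rs b} → Occurrences (conj a t) rs b → Occurrences t (map (conj a) rs) b
    occurrences-conj a done = done
    occurrences-conj a (step r o) = step (reflects-⇔ (conj-swapˡ a) (conj-swapʳ a) r) (occurrences-conj a o)

    crossings⇒occurrences : ∀ {t x b} → Crossings t x b → Occurrences t (reflections x) b
    crossings⇒occurrences done = done
    crossings⇒occurrences {x = a ∷ _} (step r rest) = step r (occurrences-conj a (crossings⇒occurrences rest))

    occurrences-split : ∀ {t} rs {rs′ b} → Occurrences t (rs ++ rs′) b →
      Σ Bool λ b₁ → Σ Bool λ b₂ → Occurrences t rs b₁ × Occurrences t rs′ b₂ × b ≡ b₁ xor b₂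
    occurrences-split [] o = false , _ , done , o , refl
    occurrences-split (r ∷ rs) (step {c = c} ref o) with occurrences-split rs o
    ... | b₁ , b₂ , o₁ , o₂ , refl = c xor b₁ , b₂ , step ref o₁ , o₂ , sym (BoolP.xor-assoc c b₁ b₂)

    occurrences-pointwise : ∀ {t rs rs′ b} → Pointwise _≈_ rs rs′ → Occurrences t rs b → Occurrences t rs′ b
    occurrences-pointwise [] done = done
    occurrences-pointwise (r≈r′ ∷ rs≈rs′) (step ref o) =
      step (reflects-⇔ (≈-trans (≈-sym r≈r′)) (≈-trans r≈r′) ref) (occurrences-pointwise rs≈rs′ o)

    module Dihedral (i j : Fin k) where

      reflection : ℕ → Word k
      reflection p = alt i j p ++ i ∷ []

      reflectionsFrom : ℕ → ℕ → List (Word k)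
      reflectionsFrom s zero = []
      reflectionsFrom s (suc c) = reflection s ∷ reflectionsFrom (suc s) c

      conj-reflection : ∀ s → conj i (conj j (reflection s)) ≡ reflection (suc (suc s))
      conj-reflection s = cong (λ u → i ∷ j ∷ u) (begin
        ((alt i j s ++ i ∷ []) ++ j ∷ []) ++ i ∷ []  ≡⟨ ListP.++-assoc (alt i j s ++ i ∷ []) (j ∷ []) (i ∷ []) ⟩
        (alt i j s ++ i ∷ []) ++ j ∷ i ∷ []          ≡⟨ ListP.++-assoc (alt i j s) (i ∷ []) (j ∷ i ∷ []) ⟩
        alt i j s ++ i ∷ j ∷ i ∷ []                  ≡⟨ ListP.++-assoc (alt i j s) (i ∷ j ∷ []) (i ∷ []) ⟨
        (alt i j s ++ i ∷ j ∷ []) ++ i ∷ []          ≡⟨ cong (_++ i ∷ []) (alt-suc-snoc i j s) ⟨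
        reflection (suc s)                           ∎)
        where open ≡-Reasoning

      conj-reflectionsFrom : ∀ s c → map (conj i) (map (conj j) (reflectionsFrom s c)) ≡ reflectionsFrom (suc (suc s)) c
      conj-reflectionsFrom s zero = refl
      conj-reflectionsFrom s (suc c) = cong₂ _∷_ (conj-reflection s) (conj-reflectionsFrom (suc s) c)

      reflections-alt : ∀ q → reflections (alt i j q) ≡ reflectionsFrom 0 (q ℕ.+ q)
      reflections-alt zero = refl
      reflections-alt (suc q) rewrite ℕP.+-suc q q | reflections-alt q =
        cong (λ rs → reflection 0 ∷ reflection 1 ∷ rs) (conj-reflectionsFrom 0 (q ℕ.+ q))

      reflectionsFrom-+ : ∀ s a b → reflectionsFrom s (a ℕ.+ b) ≡ reflectionsFrom s a ++ reflectionsFrom (s ℕ.+ a) b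
      reflectionsFrom-+ s zero b rewrite ℕP.+-identityʳ s = refl
      reflectionsFrom-+ s (suc a) b rewrite ℕP.+-suc s a = cong (reflection s ∷_) (reflectionsFrom-+ (suc s) a b)

      module _ (n : ℕ) (i≢j : i ≢ j) (mᵢⱼ : m i j ≡ just n) where

        alt≈[] : alt i j n ≈ []
        alt≈[] = ≈-trans (≡⇒≈ (sym (ListP.++-identityʳ (alt i j n)))) (≈-braid [] [] i j n i≢j mᵢⱼ)

        reflection-periodic : ∀ p → reflection (n ℕ.+ p) ≈ reflection p
        reflection-periodic p =
          ≈-trans (≡⇒≈ (trans (cong (_++ i ∷ []) (alt-+ i j n p)) (ListP.++-assoc (alt i j n) (alt i j p) (i ∷ []))))
                  (≈-braid [] (alt i j p ++ i ∷ []) i j n i≢j mᵢⱼ)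

        reflectionsFrom-periodic : ∀ s c → Pointwise _≈_ (reflectionsFrom (n ℕ.+ s) c) (reflectionsFrom s c)
        reflectionsFrom-periodic s zero = []
        reflectionsFrom-periodic s (suc c) =
          reflection-periodic s ∷ subst (λ s′ → Pointwise _≈_ (reflectionsFrom s′ c) (reflectionsFrom (suc s) c)) (ℕP.+-suc n s) (reflectionsFrom-periodic (suc s) c)

        -- The 2n reflections of (s_i s_j)ⁿ are the first n ones twice, so every wall is crossed evenly.
        crossings-alt : ∀ {t b} → Crossings t (alt i j n) b → b ≡ false
        crossings-alt c with occurrences-split (reflectionsFrom 0 n)
                               (subst (λ rs → Occurrences _ rs _) (trans (reflections-alt n) (reflectionsFrom-+ 0 n n)) (crossings⇒occurrences c))
        ... | b₁ , b₂ , o₁ , o₂ , refl = trans (cong (b₁ xor_) (occurrences-unique (occurrences-pointwise second≈first o₂) o₁)) (BoolP.xor-same b₁)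
          where
          second≈first : Pointwise _≈_ (reflectionsFrom n n) (reflectionsFrom 0 n)
          second≈first = subst (λ s → Pointwise _≈_ (reflectionsFrom s n) (reflectionsFrom 0 n)) (ℕP.+-identityʳ n) (reflectionsFrom-periodic 0 n)

    crossings-respects : ∀ {u v} → u ≈ v → ∀ {t b b′} → Crossings t u b → Crossings t v b′ → b ≡ b′
    crossings-respects ≈-refl cu cv = crossings-unique cu cv
    crossings-respects (≈-sym v≈u) cu cv = sym (crossings-respects v≈u cv cu)
    crossings-respects (≈-trans {v = w} u≈w w≈v) {t} {b} {b′} cu cv = decidable-stable (b BoolP.≟ b′)
      (λ b≢b′ → ¬¬-crossings t w (λ (b″ , cw) → b≢b′ (trans (crossings-respects u≈w cu cw) (crossings-respects w≈v cw cv))))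
    crossings-respects (≈-sq u v i) cu cv with crossings-split u cu | crossings-split u cv
    ... | b₁ , _ , cu₁ , step {c = c₁} r₁ (step {c = c₂} r₂ rest) , refl | b₁′ , _ , cv₁ , cv₂ , refl =
      cong₂ _xor_ (crossings-unique cu₁ cv₁)
                  (trans (cong (λ c → c₁ xor (c xor _)) (sym c₁≡c₂)) (trans (xor-cancelˡ c₁ _) (crossings-unique (crossings-cong (conj-involutive i _) rest) cv₂)))
      where
      c₁≡c₂ : c₁ ≡ c₂
      c₁≡c₂ = Reflects.det (reflects-⇔ (λ i≈w → conj-swapʳ i (≈-trans (≈-sq [] (i ∷ []) i) i≈w))
                                        (λ i≈iwi → ≈-trans (≈-sym (≈-sq [] (i ∷ []) i)) (conj-swapˡ i i≈iwi)) r₁) r₂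
    crossings-respects (≈-braid u v i j n i≢j mᵢⱼ) {t} cu cv with crossings-split u cu | crossings-split u cv
    ... | b₁ , _ , cu₁ , cu₂ , refl | b₁′ , _ , cv₁ , cv₂ , refl with crossings-split (alt i j n) cu₂
    ... | c₁ , c₂ , calt , rest , refl =
      cong₂ _xor_ (crossings-unique cu₁ cv₁) (trans (cong (_xor c₂) (Dihedral.crossings-alt i j n i≢j mᵢⱼ calt)) (crossings-unique (crossings-cong frame≈ rest) cv₂))
      where
      w : Word k
      w = frame t u
      alt≈[] : alt i j n ≈ []
      alt≈[] = Dihedral.alt≈[] i j n i≢j mᵢⱼ
      frame≈ : frame w (alt i j n) ≈ w
      frame≈ = ≈-trans (frame-≈ w (alt i j n)) (≈-trans (≈-congʳ (w ++ alt i j n) (reverse-identity (alt i j n) alt≈[]))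
                 (≈-trans (≈-congˡ w alt≈[]) (≡⇒≈ (ListP.++-identityʳ w))))

    -- The exchange condition: t u loses the letter of u at its first crossing of the wall.
    crossing⇒shorter : ∀ {t u b} → Crossings t u b → b ≡ true → Σ (Word k) λ u′ → suc (length u′) ≡ length u × (t ++ u) ≈ u′
    crossing⇒shorter done ()
    crossing⇒shorter {t} (step {a = a} {x = x} (ofʸ a≈t) rest) _ = x , refl , ≈-trans (≈-congʳ (a ∷ x) (≈-sym a≈t)) (≈-sq [] x a)
    crossing⇒shorter {t} (step {a = a} {x = x} (ofⁿ _) rest) odd with crossing⇒shorter rest odd
    ... | x′ , len , tx≈x′ = a ∷ x′ , cong suc len ,
        ≈-trans (≈-sym (≈-sq [] (t ++ a ∷ x) a)) (≈-trans (≡⇒≈ (cong (λ u → a ∷ a ∷ u) (sym (ListP.++-assoc t (a ∷ []) x)))) (≈-congˡ (a ∷ []) tx≈x′))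

module ReflectionPrinciple where
  open import Defs
  open CoxeterWords
  open Crossings
  open import Data.Nat as ℕ using (ℕ; zero; suc; _≤_; z≤n; s≤s)
  import Data.Nat.Properties as ℕP
  open import Data.Fin using (Fin; zero; suc)
  import Data.Fin.Properties as FinP
  open import Data.Vec using (Vec; []; _∷_; toList)
  open import Data.List using (List; []; _∷_; _++_; length; map)
  import Data.List.Properties as ListP
  open import Data.List.Membership.Propositional using (_∈_)
  open import Data.List.Membership.Propositional.Properties using (∈-∃++; ∈-++⁻; ∈-++⁺ˡ; ∈-++⁺ʳ; ∈-map⁻)
  open import Data.List.Relation.Unary.Unique.Propositional using (Unique)
  import Data.List.Relation.Unary.Unique.Propositional.Properties as UniqueP
  open import Data.List.Relation.Unary.AllPairs using (_∷_)
  import Data.List.Relation.Unary.All as All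
  open import Data.List.Relation.Unary.Any using (here; there)
  open import Data.Bool using (true; false)
  open import Data.Unit using (⊤; tt)
  open import Data.Product using (_×_; _,_)
  open import Data.Sum using (_⊎_; inj₁; inj₂)
  open import Data.Empty using (⊥-elim)
  open import Function using (_∘_)
  open import Function.Bundles using (Equivalence)
  open import Relation.Binary.PropositionalEquality
  open import Relation.Nullary using (¬_; Dec; yes; no; ofⁿ)
  open import Relation.Nullary.Decidable using (¬¬-excluded-middle)

  unique-⊆⇒length-≤ : ∀ {A : Set} (xs ys : List A) → Unique xs → (∀ {x} → x ∈ xs → x ∈ ys) → length xs ≤ length ys
  unique-⊆⇒length-≤ [] ys _ _ = z≤n
  unique-⊆⇒length-≤ (x ∷ xs) ys (x∉xs ∷ unique) xs⊆ys with ∈-∃++ (xs⊆ys (here refl))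
  ... | ys₁ , ys₂ , refl = ℕP.≤-trans (s≤s (unique-⊆⇒length-≤ xs (ys₁ ++ ys₂) unique xs⊆ys₁ys₂)) (ℕP.≤-reflexive (sym length-removed))
    where
    length-removed : length (ys₁ ++ x ∷ ys₂) ≡ suc (length (ys₁ ++ ys₂))
    length-removed = trans (ListP.length-++ ys₁) (trans (ℕP.+-suc (length ys₁) (length ys₂)) (cong suc (sym (ListP.length-++ ys₁))))
    xs⊆ys₁ys₂ : ∀ {y} → y ∈ xs → y ∈ ys₁ ++ ys₂
    xs⊆ys₁ys₂ {y} y∈xs with ∈-++⁻ ys₁ (xs⊆ys (there y∈xs))
    ... | inj₁ y∈ys₁ = ∈-++⁺ˡ y∈ys₁
    ... | inj₂ (here y≡x) = ⊥-elim (All.lookup x∉xs y∈xs (sym y≡x))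
    ... | inj₂ (there y∈ys₂) = ∈-++⁺ʳ ys₁ y∈ys₂

  ¬¬-Π-Fin : ∀ {n} {P : Fin n → Set} → (∀ i → ¬ ¬ P i) → ¬ ¬ (∀ i → P i)
  ¬¬-Π-Fin {zero} _ ¬all = ¬all (λ ())
  ¬¬-Π-Fin {suc n} {P} ¬¬P ¬all =
    ¬¬P zero (λ p₀ → ¬¬-Π-Fin {n} {P ∘ suc} (¬¬P ∘ suc) (λ ps → ¬all (λ { zero → p₀ ; (suc i) → ps i })))

  module Walks {k : ℕ} (m : CoxMatrix k) (generators-distinct : ∀ a a′ → (a ∷ []) ≈⟨ m ⟩ (a′ ∷ []) → a ≡ a′) where
    open Words m
    open CrossingParity m

    position : ∀ {n} → Vec (Step k) n → Word k
    position σ = walkWord (toList σ)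

    conjStep : Step k → Word k → Word k
    conjStep zero t = t
    conjStep (suc a) t = conj a t

    -- The decisions needed to reflect every walk of length n in the wall t: which generators
    -- equal t now, and recursively the same for the wall seen after each possible step.
    Oracle : Word k → ℕ → Set
    Oracle t zero = ⊤
    Oracle t (suc n) = ((a : Fin k) → Dec ((a ∷ []) ≈ t)) × ((c : Step k) → Oracle (conjStep c t) n)

    ¬¬-oracle : ∀ n t → ¬ ¬ Oracle t n
    ¬¬-oracle zero t ¬o = ¬o tt
    ¬¬-oracle (suc n) t ¬o = ¬¬-Π-Fin (λ a → ¬¬-excluded-middle) (λ decide → ¬¬-Π-Fin (λ c → ¬¬-oracle n (conjStep c t)) (λ next → ¬o (decide , next)))

    -- Follow the walk until it first touches the wall: there an idle step is replaced by the
    -- generator equal to the wall, or that generator by an idle step; the rest is kept.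
    -- Afterwards the walk is the original one reflected in the wall.
    reflectWalk : ∀ {t n} → Oracle t n → Vec (Step k) n → Vec (Step k) n
    reflectWalk {n = zero} _ [] = []
    reflectWalk {n = suc n} (decide , next) (zero ∷ σ) with FinP.any? decide
    ... | yes (a , _) = suc a ∷ σ
    ... | no _ = zero ∷ reflectWalk (next zero) σ
    reflectWalk {n = suc n} (decide , next) (suc a ∷ σ) with decide a
    ... | yes _ = zero ∷ σ
    ... | no _ = suc a ∷ reflectWalk (next (suc a)) σ

    reflectWalk-involutive : ∀ {t n} (o : Oracle t n) σ → reflectWalk o (reflectWalk o σ) ≡ σ
    reflectWalk-involutive {n = zero} _ [] = refl
    reflectWalk-involutive {n = suc n} (decide , next) (zero ∷ σ) with FinP.any? decide
    ... | yes (a , a≈t) with decide a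
    ...   | yes _ = refl
    ...   | no a≉t = ⊥-elim (a≉t a≈t)
    reflectWalk-involutive {n = suc n} (decide , next) (zero ∷ σ) | no none with FinP.any? decide
    ...   | yes some = ⊥-elim (none some)
    ...   | no _ = cong (zero ∷_) (reflectWalk-involutive (next zero) σ)
    reflectWalk-involutive {n = suc n} (decide , next) (suc a ∷ σ) with decide a
    ... | yes a≈t with FinP.any? decide
    ...   | yes (a′ , a′≈t) = cong (λ b → suc b ∷ σ) (generators-distinct a′ a (≈-trans a′≈t (≈-sym a≈t)))
    ...   | no none = ⊥-elim (none (a , a≈t))
    reflectWalk-involutive {n = suc n} (decide , next) (suc a ∷ σ) | no a≉t with decide a
    ...   | yes a≈t = ⊥-elim (a≉t a≈t)
    ...   | no _ = cong (suc a ∷_) (reflectWalk-involutive (next (suc a)) σ)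

    reflectWalk-injective : ∀ {t n} (o : Oracle t n) {σ σ′} → reflectWalk o σ ≡ reflectWalk o σ′ → σ ≡ σ′
    reflectWalk-injective o {σ} {σ′} eq = trans (sym (reflectWalk-involutive o σ)) (trans (cong (reflectWalk o) eq) (reflectWalk-involutive o σ′))

    reflectWalk-position : ∀ {t n} (o : Oracle t n) σ → (position (reflectWalk o σ) ≈ (t ++ position σ)) ⊎ Crossings t (position σ) false
    reflectWalk-position {n = zero} _ [] = inj₂ done
    reflectWalk-position {t} {suc n} (decide , next) (zero ∷ σ) with FinP.any? decide
    ... | yes (a , a≈t) = inj₁ (≈-congʳ (position σ) a≈t)
    ... | no _ = reflectWalk-position (next zero) σ
    reflectWalk-position {t} {suc n} (decide , next) (suc a ∷ σ) with decide a
    ... | yes a≈t = inj₁ (≈-sym (≈-trans (≈-congʳ (a ∷ position σ) (≈-sym a≈t)) (≈-sq [] (position σ) a)))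
    ... | no a≉t with reflectWalk-position (next (suc a)) σ
    ...   | inj₁ reflected = inj₁ (≈-trans (≈-congˡ (a ∷ []) reflected)
                              (≈-trans (≡⇒≈ (cong (λ u → a ∷ a ∷ u) (ListP.++-assoc t (a ∷ []) (position σ)))) (≈-sq [] (t ++ a ∷ position σ) a)))
    ...   | inj₂ uncrossed = inj₂ (step (ofⁿ a≉t) uncrossed)

    -- Reflection principle: if the galleries to x cross the wall of t oddly, reflecting the
    -- walks ending at x injects them into the walks ending at t x.
    count-≤-reflected : ∀ {n t x y c c′} → Crossings t x true → (t ++ x) ≈ y →
                        WalkCount m n x c → WalkCount m n y c′ → ¬ ¬ (c ≤ c′)
    count-≤-reflected {n} {t} {x} {y} {c} {c′} x-crosses tx≈y (Lx , unique-x , length-x , walks-x) (Ly , _ , length-y , walks-y) ¬c≤c′ =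
      ¬¬-oracle n t (λ o → ¬c≤c′ (subst₂ _≤_ (trans (ListP.length-map (reflectWalk o) Lx) length-x) length-y
        (unique-⊆⇒length-≤ (map (reflectWalk o) Lx) Ly (UniqueP.map⁺ (reflectWalk-injective o) unique-x) (reflected⊆ o))))
      where
      reflected⊆ : ∀ o {σ′} → σ′ ∈ map (reflectWalk o) Lx → σ′ ∈ Ly
      reflected⊆ o σ′∈ with ∈-map⁻ (reflectWalk o) σ′∈
      ... | σ , σ∈Lx , refl = Equivalence.from (walks-y (reflectWalk o σ)) ends-at-y
        where
        ends-at-x : position σ ≈ x
        ends-at-x = Equivalence.to (walks-x σ) σ∈Lx
        ends-at-y : position (reflectWalk o σ) ≈ y
        ends-at-y with reflectWalk-position o σ
        ... | inj₁ reflected = ≈-trans reflected (≈-trans (≈-congˡ t ends-at-x) tx≈y)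
        ... | inj₂ uncrossed with () ← crossings-respects ends-at-x uncrossed x-crosses

open import Defs
open CoxeterWords using (module Words)
open Crossings using (module CrossingParity)
open ReflectionPrinciple using (module Walks)
open GeneratorsDistinct using (module Distinct)
open import Data.Nat as ℕ using (ℕ; _<_; _^_; suc; NonZero)
import Data.Nat.Properties as ℕP
open import Data.Fin using (Fin)
open import Data.List using (_∷_; []; _++_; length)
open import Data.Bool using (true; false)
open import Data.Integer using (+_; +≤+)
import Data.Integer.Properties as ℤP
open import Data.Rational.Unnormalised using (ℚᵘ; _≤_; _/_; *≤*)
open import Data.Product using (Σ; _×_; _,_)
open import Relation.Binary.PropositionalEquality
open import Relation.Nullary using (¬_; ofʸ)
open import Relation.Nullary.Decidable using (decidable-stable)

module _ {k : ℕ} (m : CoxMatrix k) where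
  open Words m
  open CrossingParity m

  shorter-side-uncrossed : ∀ {w s a b} → HasLength m w a → HasLength m (w ++ s ∷ []) b → a < b → ¬ Crossings (reflectionOf w s) w true
  shorter-side-uncrossed {w} {s} {a} {b} ((u , u≈w , length-u) , _) (_ , minimal) a<b w-crosses =
    ¬¬-crossings (reflectionOf w s) u λ (_ , u-crosses) → shorter (crossing⇒shorter u-crosses (crossings-respects u≈w u-crosses w-crosses))
    where
    shorter : ¬ Σ (Word k) λ u′ → suc (length u′) ≡ length u × (reflectionOf w s ++ u) ≈ u′
    shorter (u′ , length-u′ , tu≈u′) = ℕP.<-irrefl refl (begin-strict
      b                ≤⟨ minimal u′ u′≈ws ⟩
      length u′        <⟨ ℕP.n<1+n (length u′) ⟩
      suc (length u′)  ≡⟨ trans length-u′ length-u ⟩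
      a                <⟨ a<b ⟩
      b                ∎)
      where
      open ℕP.≤-Reasoning
      u′≈ws : u′ ≈ (w ++ s ∷ [])
      u′≈ws = ≈-trans (≈-sym tu≈u′) (≈-trans (≈-congˡ (reflectionOf w s) u≈w) (reflectionOf-++ w s))

  ¬¬-longer-side-crossed : ∀ {w s a b} → HasLength m w a → HasLength m (w ++ s ∷ []) b → a < b → ¬ ¬ Crossings (reflectionOf w s) (w ++ s ∷ []) true
  ¬¬-longer-side-crossed {w} {s} length-w length-ws a<b ¬crossed = ¬¬-crossings (reflectionOf w s) w λ where
    (false , w-crosses) → ¬crossed (crossings-++ w-crosses (step (ofʸ (≈-sym (frame-reflectionOf w s))) done))
    (true , w-crosses) → shorter-side-uncrossed length-w length-ws a<b w-crosses

/-mono-≤ : ∀ D .{{_ : NonZero D}} {c c′} → c ℕ.≤ c′ → (+ c) / D ≤ (+ c′) / D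
/-mono-≤ (suc d) c≤c′ = *≤* (ℤP.*-monoʳ-≤-nonNeg (+ suc d) (+≤+ c≤c′))

proposition3p1 : (k : ℕ) (m : CoxMatrix k) → IsCoxeterMatrix m →
    (w : Word k) (s : Fin k) →
    Σ ℕ (λ a → Σ ℕ (λ b → HasLength m w a × HasLength m (w ++ s ∷ []) b × a < b)) →
    (n : ℕ) (p q : ℚᵘ) → WalkProb m n (w ++ s ∷ []) p → WalkProb m n w q → p ≤ q
proposition3p1 k m cox w s (_ , _ , length-w , length-ws , a<b) n _ _ (c , count-ws , refl) (c′ , count-w , refl) =
  /-mono-≤ (suc k ^ n) {{ℕP.m^n≢0 (suc k) n}} (decidable-stable (c ℕ.≤? c′) λ c≰c′ →
    ¬¬-longer-side-crossed m length-w length-ws a<b λ ws-crosses →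
      count-≤-reflected ws-crosses (reflectionOf-++-s w s) count-ws count-w c≰c′)
  where
  open Words m
  open Walks m (Distinct.generators-distinct m cox)
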